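{- Let $\Psi\in\{\mathfrak F,\mathfrak B\}$, let $\alpha,\beta$ satisfy $2<\alpha\le 3$ and $4\alpha-\beta=6$, and let $G\in\mathcal G(\Psi,\alpha,\beta)$. Then $G$ has no vertex cut $M$ with $G|_M$ isomorphic to the 4-cycle $C_4$.
   Context: All graphs are finite and simple. $|G|$ is the number of vertices, $e(G)$ the number of edges, $G|_X$ the subgraph induced on $X$. $q_{\alpha,\beta}(G)=\alpha|G|-e(G)-\beta$. $\mathfrak F$ is the class of forests and $\mathfrak B$ the class of bipartite graphs. A vertex cut is a vertex set whose removal disconnects the graph; a $\Psi$-cut of $G$ is a vertex cut $M$ with $G|_M\in\Psi$. $\mathcal G(\Psi,\alpha,\beta)$ is the set of graphs $G$ such that $|G|\ge4$, $q_{\alpha,\beta}(G)>0$, $G$ has no $\Psi$-cut, and $G$ has the smallest number of vertices among all graphs with these three properties.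
   Formalization: The parameters α and β are taken in ℚ rather than in ℝ. -}

module Defs where

open import Data.Nat using (ℕ; zero; suc; _<ᵇ_)
open import Data.Bool using (Bool; true; false; _∧_; if_then_else_)
open import Data.Fin using (Fin; toℕ)
open import Data.Fin.Subset using (Subset; _∈_; _∉_; ∣_∣)
open import Data.Vec using (Vec; lookup)
open import Data.List using (List; allFin; filter; length; concatMap; map; _∷_; [])
open import Data.Product using (Σ; ∃; ∃-syntax; _×_; _,_)
open import Data.Integer using (+_)
open import Data.Rational using (ℚ; _/_; _*_; _-_; _<_; _≤_; 0ℚ)
open import Relation.Binary.PropositionalEquality using (_≡_)
open import Relation.Nullary using (¬_)
open import Relation.Nullary.Decidable using (T?)
import Data.Nat
import Data.Nat.Properties
import Data.Fin
import Data.Bool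
open import Function.Definitions using (Injective)

record Graph : Set where
  field
    n      : ℕ
    adj    : Fin n → Fin n → Bool
    sym    : ∀ i j → adj i j ≡ adj j i
    irrefl : ∀ i → adj i i ≡ false
open Graph public

∣_∣ᵥ : Graph → ℕ
∣ G ∣ᵥ = n G

edgeCount : Graph → ℕ
edgeCount G = length (filter (λ p → T? (edgeAt p))
                              (concatMap (λ i → map (λ j → i , j) (allFin (n G))) (allFin (n G))))
  where
  edgeAt : Fin (n G) × Fin (n G) → Bool
  edgeAt (i , j) = (toℕ i <ᵇ toℕ j) ∧ adj G i j

ℕ→ℚ : ℕ → ℚ
ℕ→ℚ k = (+ k) / 1

q : ℚ → ℚ → Graph → ℚ
q α β G = (α * ℕ→ℚ ∣ G ∣ᵥ - ℕ→ℚ (edgeCount G)) - β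

data ConnAvoid (G : Graph) (M : Subset (n G)) : Fin (n G) → Fin (n G) → Set where
  here : ∀ {u} → u ∉ M → ConnAvoid G M u u
  step : ∀ {u w v} → u ∉ M → adj G u w ≡ true → ConnAvoid G M w v → ConnAvoid G M u v

IsVertexCut : (G : Graph) → Subset (n G) → Set
IsVertexCut G M = ∃[ u ] ∃[ v ] (u ∉ M × v ∉ M × ¬ ConnAvoid G M u v)

-- A cycle of length k+3 in G all of whose vertices lie in M
-- (i.e. a cycle of the induced subgraph G|_M).
record CycleIn (G : Graph) (M : Subset (n G)) : Set where
  field
    k      : ℕ
    vs     : Fin (suc (suc (suc k))) → Fin (n G)
    inj    : Injective _≡_ _≡_ vs
    inside : ∀ i → vs i ∈ M
    edges  : ∀ (i : Fin (suc (suc k))) →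
               adj G (vs (Data.Fin.inject₁ i)) (vs (Data.Fin.suc i)) ≡ true
    closing : adj G (vs (Data.Fin.fromℕ (suc (suc k)))) (vs Data.Fin.zero) ≡ true

InducedForest : (G : Graph) → Subset (n G) → Set
InducedForest G M = ¬ CycleIn G M

InducedBipartite : (G : Graph) → Subset (n G) → Set
InducedBipartite G M =
  Σ (Fin (n G) → Bool) λ c →
    ∀ (u v : Fin (n G)) → u ∈ M → v ∈ M → adj G u v ≡ true → ¬ (c u ≡ c v)

data GraphClass : Set where
  𝔉 𝔅 : GraphClass

InducedIn : GraphClass → (G : Graph) → Subset (n G) → Set
InducedIn 𝔉 G M = InducedForest G M
InducedIn 𝔅 G M = InducedBipartite G M

IsΨCut : GraphClass → (G : Graph) → Subset (n G) → Set
IsΨCut Ψ G M = IsVertexCut G M × InducedIn Ψ G M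

HasNoΨCut : GraphClass → Graph → Set
HasNoΨCut Ψ G = ∀ (M : Subset (n G)) → ¬ IsΨCut Ψ G M

Admissible : GraphClass → ℚ → ℚ → Graph → Set
Admissible Ψ α β G = (4 Data.Nat.≤ ∣ G ∣ᵥ) × (0ℚ < q α β G) × HasNoΨCut Ψ G

In𝒢 : GraphClass → ℚ → ℚ → Graph → Set
In𝒢 Ψ α β G = Admissible Ψ α β G × (∀ H → Admissible Ψ α β H → ∣ G ∣ᵥ Data.Nat.≤ ∣ H ∣ᵥ)

-- adjacency of the 4-cycle C4 on Fin 4 : 0-1-2-3-0
c4adj : Fin 4 → Fin 4 → Bool
c4adj i j = ((toℕ i Data.Nat.+ 1) Data.Nat.≡ᵇ toℕ j) Data.Bool.∨ ((toℕ j Data.Nat.+ 1) Data.Nat.≡ᵇ toℕ i)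
            Data.Bool.∨ (((toℕ i Data.Nat.+ toℕ j) Data.Nat.≡ᵇ 3) Data.Bool.∧ ((toℕ i Data.Nat.≡ᵇ 0) Data.Bool.∨ (toℕ j Data.Nat.≡ᵇ 0)))

InducedC4 : (G : Graph) → Subset (n G) → Set
InducedC4 G M =
  Σ (Fin 4 → Fin (n G)) λ f →
         (Injective _≡_ _≡_ f
         × (∀ i → f i ∈ M)
         × (∀ v → v ∈ M → ∃[ i ] f i ≡ v)
         × (∀ i j → adj G (f i) (f j) ≡ c4adj i j))

-- The bipartite case is immediate: C4 is bipartite, so M itself would be a 𝔅-cut. For forests, let A be
-- the component of G − M containing one of the two separated vertices and B the rest of G − M, and for
-- edge sets X, Y inside M let G_A = (G + X)[M ∪ A] and G_B = (G + Y)[M ∪ B]. Both are smaller than G and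
-- have at least four vertices. If X and Y add two edges in total, then |G_A| + |G_B| = |G| + 4 and
-- e(G_A) + e(G_B) = e(G) + 6, so 4α − β = 6 gives q(G_A) + q(G_B) = q(G) > 0, and by minimality G_A or
-- G_B has a forest cut. Such a cut would be a forest cut of G unless it meets the 4-cycle f0 f1 f2 f3 in a
-- diagonal, say {f0, f2}, and separates f1 from f3 inside its part; two such separators on opposite sides,
-- one for G + f0f2 and one for G, glue to a forest cut of G separating f1 from f3. Whichever separators
-- exist, some choice of X, Y among ∅, f0f2, f1f3 and both diagonals leaves both parts without forest cuts.

module Submission where

open import Defs renaming (sym to adj-sym; irrefl to adj-irrefl)
open import Data.Bool using (Bool; true; false; not; _∧_; _∨_) renaming (_≟_ to _≟ᵇ_)
open import Data.Bool.Properties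
  using (∨-zeroʳ; ∨-identityʳ; ∨-comm; ∧-comm; ∨-conicalˡ; ∨-conicalʳ; not-involutive)
open import Data.Empty using (⊥; ⊥-elim; ⊥-elim-irr)
open import Data.Fin using (Fin; zero; suc; toℕ; fromℕ; inject₁; _≟_)
open import Data.Fin.Properties using (suc-injective; fromℕ≢inject₁; inject₁-injective; toℕ-inject₁; any?; sequence)
open import Data.Fin.Subset using (Subset; _∈_; _∉_)
open import Data.List using (List; []; _∷_)
open import Data.List.Relation.Unary.Any using (here; there)
open import Data.List.Membership.Propositional using () renaming (_∈_ to _∈ˡ_)
import Data.List.Membership.DecPropositional as DecMembership
open import Data.Nat using (ℕ; zero; suc; pred)
open import Data.Product using (Σ; _×_; _,_; proj₁; proj₂)
open import Data.Rational using (ℚ; 0ℚ)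
import Data.Rational as ℚ
open import Data.Sum using (_⊎_; inj₁; inj₂; [_,_])
open import Data.Vec using (lookup; tabulate)
open import Data.Vec.Properties using (lookup∘tabulate; []=⇒lookup; lookup⇒[]=)
open import Effect.Monad using (RawMonad)
open import Function using (_∘_; id)
open import Function.Definitions using (Injective)
open import Relation.Binary.PropositionalEquality hiding ([_])
open import Relation.Nullary using (¬_; Dec; yes; no; does)
open import Relation.Nullary.Decidable using (_×-dec_; ¬¬-excluded-middle)
open import Relation.Nullary.Negation using (¬¬-Monad)

data Walk {V : Set} (R : V → V → Set) (Ok : V → Set) : V → V → Set where
  here : ∀ {x} → Ok x → Walk R Ok x x
  step : ∀ {x y z} → Ok x → R x y → Walk R Ok y z → Walk R Ok x z

module _ {V : Set} {R : V → V → Set} {Ok : V → Set} where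

  source-ok : ∀ {x y} → Walk R Ok x y → Ok x
  source-ok (here o)     = o
  source-ok (step o _ _) = o

  target-ok : ∀ {x y} → Walk R Ok x y → Ok y
  target-ok (here o)     = o
  target-ok (step _ _ w) = target-ok w

  _++ʷ_ : ∀ {x y z} → Walk R Ok x y → Walk R Ok y z → Walk R Ok x z
  here _     ++ʷ w′ = w′
  step o r w ++ʷ w′ = step o r (w ++ʷ w′)

  snocʷ : ∀ {x y z} → Walk R Ok x y → R y z → Ok z → Walk R Ok x z
  snocʷ w r o = w ++ʷ step (target-ok w) r (here o)

  reverseʷ : (∀ {x y} → R x y → R y x) → ∀ {x y} → Walk R Ok x y → Walk R Ok y x
  reverseʷ R-sym (here o)     = here o
  reverseʷ R-sym (step o r w) = snocʷ (reverseʷ R-sym w) (R-sym r) o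

mapʷ : ∀ {V : Set} {R R′ : V → V → Set} {Ok Ok′ : V → Set} →
       (∀ {x y} → R x y → R′ x y) → (∀ {x} → Ok x → Ok′ x) →
       ∀ {x y} → Walk R Ok x y → Walk R′ Ok′ x y
mapʷ f g (here o)     = here (g o)
mapʷ f g (step o r w) = step (g o) (f r) (mapʷ f g w)

Adj : (G : Graph) → Fin (n G) → Fin (n G) → Set
Adj G x y = adj G x y ≡ true

true≢false : true ≢ false
true≢false ()

Adj-sym : (G : Graph) → ∀ {x y} → Adj G x y → Adj G y x
Adj-sym G {x} {y} = trans (adj-sym G y x)

lookup⇒∉ : ∀ {n} {M : Subset n} {v} → lookup M v ≡ false → v ∉ M
lookup⇒∉ Mv v∈M with () ← trans (sym ([]=⇒lookup v∈M)) Mv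

∉⇒lookup : ∀ {n} {M : Subset n} {v} → v ∉ M → lookup M v ≡ false
∉⇒lookup {M = M} {v} v∉M with lookup M v in Mv
... | true  = ⊥-elim (v∉M (lookup⇒[]= v M Mv))
... | false = refl

∈-tabulate⁺ : ∀ {n} (P : Fin n → Bool) {v} → P v ≡ true → v ∈ tabulate P
∈-tabulate⁺ P {v} Pv = lookup⇒[]= v (tabulate P) (trans (lookup∘tabulate P v) Pv)

∈-tabulate⁻ : ∀ {n} (P : Fin n → Bool) {v} → v ∈ tabulate P → P v ≡ true
∈-tabulate⁻ P {v} v∈ = trans (sym (lookup∘tabulate P v)) ([]=⇒lookup v∈)

∉-tabulate⁺ : ∀ {n} (P : Fin n → Bool) {v} → P v ≡ false → v ∉ tabulate P
∉-tabulate⁺ P Pv v∈ with () ← trans (sym (∈-tabulate⁻ P v∈)) Pv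

∉-tabulate⁻ : ∀ {n} (P : Fin n → Bool) {v} → v ∉ tabulate P → P v ≡ false
∉-tabulate⁻ P {v} v∉ with P v in Pv
... | true  = ⊥-elim (v∉ (∈-tabulate⁺ P Pv))
... | false = refl

record EdgeSet (n : ℕ) : Set where
  field
    edge        : Fin n → Fin n → Bool
    edge-sym    : ∀ i j → edge i j ≡ edge j i
    edge-irrefl : ∀ i → edge i i ≡ false
open EdgeSet public

∅ᴱ : ∀ {n} → EdgeSet n
∅ᴱ = record { edge = λ _ _ → false ; edge-sym = λ _ _ → refl ; edge-irrefl = λ _ → refl }

_∪ᴱ_ : (G : Graph) → EdgeSet (n G) → Graph
G ∪ᴱ X = record
  { n      = n G
  ; adj    = λ i j → adj G i j ∨ edge X i j
  ; sym    = λ i j → cong₂ _∨_ (adj-sym G i j) (edge-sym X i j)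
  ; irrefl = λ i → cong₂ _∨_ (adj-irrefl G i) (edge-irrefl X i)
  }

Adj-∪ᴱ⁺ : (G : Graph) (X : EdgeSet (n G)) → ∀ {i j} → Adj G i j → Adj (G ∪ᴱ X) i j
Adj-∪ᴱ⁺ G X Gij rewrite Gij = refl

Adj-∪ᴱ⁺ʳ : (G : Graph) (X : EdgeSet (n G)) → ∀ {i j} → edge X i j ≡ true → Adj (G ∪ᴱ X) i j
Adj-∪ᴱ⁺ʳ G X {i} {j} Xij rewrite Xij = ∨-zeroʳ (adj G i j)

Adj-∪∅ᴱ⁻ : (G : Graph) → ∀ {i j} → Adj (G ∪ᴱ ∅ᴱ) i j → Adj G i j
Adj-∪∅ᴱ⁻ G {i} {j} e = trans (sym (∨-identityʳ (adj G i j))) e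

CycleIn-∪ᴱ : (G : Graph) (X : EdgeSet (n G)) {Y : Subset (n G)} → CycleIn G Y → CycleIn (G ∪ᴱ X) Y
CycleIn-∪ᴱ G X c = record
  { k = k ; vs = vs ; inj = inj ; inside = inside
  ; edges = Adj-∪ᴱ⁺ G X ∘ edges ; closing = Adj-∪ᴱ⁺ G X closing }
  where open CycleIn c

CycleIn-∪∅ᴱ⁻ : (G : Graph) {Y : Subset (n G)} → CycleIn (G ∪ᴱ ∅ᴱ) Y → CycleIn G Y
CycleIn-∪∅ᴱ⁻ G c = record
  { k = k ; vs = vs ; inj = inj ; inside = inside
  ; edges = Adj-∪∅ᴱ⁻ G ∘ edges ; closing = Adj-∪∅ᴱ⁻ G closing }
  where open CycleIn c

module _ {n : ℕ} where

  isPair : Fin n → Fin n → Fin n → Fin n → Bool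
  isPair p q x y = (does (x ≟ p) ∧ does (y ≟ q)) ∨ (does (x ≟ q) ∧ does (y ≟ p))

  pairEdge : (p q : Fin n) → .(p ≢ q) → EdgeSet n
  pairEdge p q p≢q = record { edge = isPair p q ; edge-sym = isPair-sym ; edge-irrefl = isPair-irrefl }
    where
    isPair-sym : ∀ x y → isPair p q x y ≡ isPair p q y x
    isPair-sym x y = trans (∨-comm (does (x ≟ p) ∧ does (y ≟ q)) _)
                           (cong₂ _∨_ (∧-comm (does (x ≟ q)) _) (∧-comm (does (x ≟ p)) _))
    isPair-irrefl : ∀ x → isPair p q x x ≡ false
    isPair-irrefl x with x ≟ p | x ≟ q
    ... | yes refl | yes refl = ⊥-elim-irr (p≢q refl)
    ... | yes _    | no _     = refl
    ... | no _     | yes _    = refl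
    ... | no _     | no _     = refl

  isPair-pq : ∀ p q → isPair p q p q ≡ true
  isPair-pq p q with p ≟ p | q ≟ q
  ... | yes _ | yes _ = refl
  ... | no p≢p | _    = ⊥-elim (p≢p refl)
  ... | _     | no q≢q = ⊥-elim (q≢q refl)

  isPair-qp : ∀ p q → isPair p q q p ≡ true
  isPair-qp p q with p ≟ p | q ≟ q
  ... | yes _ | yes _ = ∨-zeroʳ _
  ... | no p≢p | _    = ⊥-elim (p≢p refl)
  ... | _     | no q≢q = ⊥-elim (q≢q refl)

  isPair⁻ : ∀ {p q x y} → isPair p q x y ≡ true → (x ≡ p × y ≡ q) ⊎ (x ≡ q × y ≡ p)
  isPair⁻ {p} {q} {x} {y} eq with x ≟ p | y ≟ q | x ≟ q | y ≟ p
  ... | yes x≡p | yes y≡q | _       | _       = inj₁ (x≡p , y≡q)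
  ... | yes _   | no _    | yes x≡q | yes y≡p = inj₂ (x≡q , y≡p)
  ... | no _    | _       | yes x≡q | yes y≡p = inj₂ (x≡q , y≡p)

  _∪ˢ_ : EdgeSet n → EdgeSet n → EdgeSet n
  X ∪ˢ Y = record
    { edge        = λ i j → edge X i j ∨ edge Y i j
    ; edge-sym    = λ i j → cong₂ _∨_ (edge-sym X i j) (edge-sym Y i j)
    ; edge-irrefl = λ i → cong₂ _∨_ (edge-irrefl X i) (edge-irrefl Y i)
    }

ConnAvoid⇒Walk : ∀ {G : Graph} (P : Fin (n G) → Bool) {x y} →
                 ConnAvoid G (tabulate P) x y → Walk (Adj G) (λ v → P v ≡ false) x y
ConnAvoid⇒Walk P (here x∉)      = here (∉-tabulate⁻ P x∉)
ConnAvoid⇒Walk P (step x∉ xy c) = step (∉-tabulate⁻ P x∉) xy (ConnAvoid⇒Walk P c)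

Walk⇒ConnAvoid : ∀ {G : Graph} {M : Subset (n G)} {x y} →
                 Walk (Adj G) (λ v → lookup M v ≡ false) x y → ConnAvoid G M x y
Walk⇒ConnAvoid (here x∉M)      = here (lookup⇒∉ x∉M)
Walk⇒ConnAvoid (step x∉M xy w) = step (lookup⇒∉ x∉M) xy (Walk⇒ConnAvoid w)

fromℕ-or-inject₁ : ∀ {m} (i : Fin (suc m)) → i ≡ fromℕ m ⊎ Σ (Fin m) λ j → i ≡ inject₁ j
fromℕ-or-inject₁ {zero}  zero    = inj₁ refl
fromℕ-or-inject₁ {suc m} zero    = inj₂ (zero , refl)
fromℕ-or-inject₁ {suc m} (suc i) with fromℕ-or-inject₁ i
... | inj₁ refl       = inj₁ refl
... | inj₂ (j , refl) = inj₂ (suc j , refl)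

cyclicSuc : ∀ {m} → Fin (suc m) → Fin (suc m)
cyclicSuc i with fromℕ-or-inject₁ i
... | inj₁ _       = zero
... | inj₂ (j , _) = suc j

cyclicSuc-inject₁ : ∀ {m} (j : Fin m) → cyclicSuc (inject₁ j) ≡ suc j
cyclicSuc-inject₁ j with fromℕ-or-inject₁ (inject₁ j)
... | inj₁ eq        = ⊥-elim (fromℕ≢inject₁ (sym eq))
... | inj₂ (j′ , eq) = cong suc (sym (inject₁-injective eq))

cyclicSuc-fromℕ : ∀ m → cyclicSuc (fromℕ m) ≡ zero
cyclicSuc-fromℕ m with fromℕ-or-inject₁ (fromℕ m)
... | inj₁ _       = refl
... | inj₂ (j , eq) = ⊥-elim (fromℕ≢inject₁ eq)

cyclicSuc-injective : ∀ {m} → Injective _≡_ _≡_ (cyclicSuc {m})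
cyclicSuc-injective {m} {a} {b} eq with fromℕ-or-inject₁ a | fromℕ-or-inject₁ b | eq
... | inj₁ refl       | inj₁ refl       | _    = refl
... | inj₂ (i , refl) | inj₂ (j , refl) | refl = refl

module _ (K : Graph) where

  private
    V : Set
    V = Fin (n K)

  rotate : ∀ {Y} → CycleIn K Y → CycleIn K Y
  rotate {Y} c = record
    { k = k ; vs = vs ∘ cyclicSuc ; inj = cyclicSuc-injective ∘ inj ; inside = inside ∘ cyclicSuc
    ; edges = edges′ ; closing = closing′ }
    where
    open CycleIn c
    edges′ : ∀ i → Adj K (vs (cyclicSuc (inject₁ i))) (vs (cyclicSuc (suc i)))
    edges′ i = subst (λ t → Adj K (vs t) (vs (cyclicSuc (suc i)))) (sym (cyclicSuc-inject₁ i))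
                     (edge-after i (fromℕ-or-inject₁ i))
      where
      edge-after : ∀ i → i ≡ fromℕ (suc k) ⊎ Σ (Fin (suc k)) (λ j → i ≡ inject₁ j) →
                   Adj K (vs (suc i)) (vs (cyclicSuc (suc i)))
      edge-after _ (inj₁ refl) =
        subst (Adj K (vs (suc (fromℕ (suc k)))) ∘ vs) (sym (cyclicSuc-fromℕ (suc (suc k)))) closing
      edge-after _ (inj₂ (j , refl)) =
        subst (Adj K (vs (suc (inject₁ j))) ∘ vs) (sym (cyclicSuc-inject₁ (suc j))) (edges (suc j))
    closing′ : Adj K (vs (cyclicSuc (fromℕ (suc (suc k))))) (vs (cyclicSuc zero))
    closing′ rewrite cyclicSuc-fromℕ (suc (suc k)) | cyclicSuc-inject₁ {suc (suc k)} zero = edges zero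

  rotate-to : ∀ {Y} (c : CycleIn K Y) (i : Fin (suc (suc (suc (CycleIn.k c))))) →
              Σ (CycleIn K Y) λ c′ → CycleIn.vs c′ zero ≡ CycleIn.vs c i
  rotate-to c i = by-index (toℕ i) c i refl
    where
    -- Recursion on toℕ i, since inject₁ j is not a structural subterm of suc j.
    by-index : ∀ {Y} t (c : CycleIn K Y) i → toℕ i ≡ t → Σ (CycleIn K Y) λ c′ → CycleIn.vs c′ zero ≡ CycleIn.vs c i
    by-index zero    c zero    _  = c , refl
    by-index (suc t) c (suc j) eq with c′ , c′₀ ← by-index t (rotate c) (inject₁ j) (trans (toℕ-inject₁ j) (cong pred eq))
      = c′ , trans c′₀ (cong (CycleIn.vs c) (cyclicSuc-inject₁ j))

  walk-along : ∀ {Ok : V → Set} m (ws : Fin (suc m) → V) →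
               (∀ i → Adj K (ws (inject₁ i)) (ws (suc i))) → (∀ i → Ok (ws i)) →
               Walk (Adj K) Ok (ws zero) (ws (fromℕ m))
  walk-along zero    ws ws-adj ws-ok = here (ws-ok zero)
  walk-along (suc m) ws ws-adj ws-ok =
    step (ws-ok zero) (ws-adj zero) (walk-along m (ws ∘ suc) (ws-adj ∘ suc) (ws-ok ∘ suc))

  record Detour (Y : V → Bool) (x : V) : Set where
    field
      {start end} : V
      walk     : Walk (Adj K) (λ v → Y v ≡ true × v ≢ x) start end
      distinct : start ≢ end
      enter    : Adj K x start
      leave    : Adj K end x

  cycle⇒detour : ∀ {Y} (c : CycleIn K (tabulate Y)) → Detour Y (CycleIn.vs c zero)
  cycle⇒detour {Y} c = record
    { walk     = walk-along (suc k) (vs ∘ suc) (edges ∘ suc) (λ i → ∈-tabulate⁻ Y (inside (suc i)) , suc≢zero ∘ inj)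
    ; distinct = suc≢zero ∘ sym ∘ suc-injective ∘ inj
    ; enter    = edges zero
    ; leave    = closing
    }
    where
    open CycleIn c
    suc≢zero : ∀ {m} {i : Fin m} → suc i ≢ zero
    suc≢zero ()

  open DecMembership (_≟_ {n K}) using () renaming (_∈?_ to _∈ˡ?_)

  data SimplePath (Ok : V → Set) : V → V → List V → Set where
    [_]ᵖ : ∀ {z} → Ok z → SimplePath Ok z z (z ∷ [])
    consᵖ : ∀ {y w z vs} → Ok y → Adj K y w → SimplePath Ok w z vs → ¬ y ∈ˡ vs → SimplePath Ok y z (y ∷ vs)

  suffixᵖ : ∀ {Ok w z vs y} → SimplePath Ok w z vs → y ∈ˡ vs → Σ (List V) (SimplePath Ok y z)
  suffixᵖ [ o ]ᵖ              (here refl) = _ , [ o ]ᵖ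
  suffixᵖ (consᵖ o r p y∉)    (here refl) = _ , consᵖ o r p y∉
  suffixᵖ (consᵖ _ _ p _)     (there y∈)  = suffixᵖ p y∈

  loop-erase : ∀ {Ok y z} → Walk (Adj K) Ok y z → Σ (List V) (SimplePath Ok y z)
  loop-erase (here o) = _ , [ o ]ᵖ
  loop-erase {y = y} (step o r w) with vs , p ← loop-erase w with y ∈ˡ? vs
  ... | yes y∈ = suffixᵖ p y∈
  ... | no  y∉ = _ , consᵖ o r p y∉

  record IndexedPath (Ok : V → Set) (y z : V) : Set where
    field
      m            : ℕ
      ws           : Fin (suc m) → V
      ws-first     : ws zero ≡ y
      ws-last      : ws (fromℕ m) ≡ z
      ws-injective : Injective _≡_ _≡_ ws
      ws-adj       : ∀ i → Adj K (ws (inject₁ i)) (ws (suc i))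
      ws-ok        : ∀ i → Ok (ws i)

  simple⇒indexed : ∀ {Ok y z vs} → SimplePath Ok y z vs →
                   Σ (IndexedPath Ok y z) λ p → ∀ i → IndexedPath.ws p i ∈ˡ vs
  simple⇒indexed {z = z} [ o ]ᵖ = record
    { m = 0 ; ws = λ _ → z ; ws-first = refl ; ws-last = refl ; ws-injective = λ { {zero} {zero} _ → refl }
    ; ws-adj = λ () ; ws-ok = λ _ → o } , λ _ → here refl
  simple⇒indexed {Ok} {y} (consᵖ o r p y∉) with p′ , ws∈ ← simple⇒indexed p = record
    { m = suc m ; ws = ws′ ; ws-first = refl ; ws-last = ws-last ; ws-injective = ws′-injective
    ; ws-adj = ws′-adj ; ws-ok = ws′-ok } , ws′∈
    where
    open IndexedPath p′
    ws′ : Fin (suc (suc m)) → V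
    ws′ zero    = y
    ws′ (suc i) = ws i
    ws′-injective : Injective _≡_ _≡_ ws′
    ws′-injective {zero}  {zero}  _  = refl
    ws′-injective {zero}  {suc j} eq = ⊥-elim (y∉ (subst (_∈ˡ _) (sym eq) (ws∈ j)))
    ws′-injective {suc i} {zero}  eq = ⊥-elim (y∉ (subst (_∈ˡ _) eq (ws∈ i)))
    ws′-injective {suc i} {suc j} eq = cong suc (ws-injective eq)
    ws′-adj : ∀ i → Adj K (ws′ (inject₁ i)) (ws′ (suc i))
    ws′-adj zero    = subst (Adj K y) (sym ws-first) r
    ws′-adj (suc i) = ws-adj i
    ws′-ok : ∀ i → Ok (ws′ i)
    ws′-ok zero    = o
    ws′-ok (suc i) = ws-ok i
    ws′∈ : ∀ i → ws′ i ∈ˡ (y ∷ _)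
    ws′∈ zero    = here refl
    ws′∈ (suc i) = there (ws∈ i)

  detour⇒cycle : ∀ {Y x} → Detour Y x → Y x ≡ true → CycleIn K (tabulate Y)
  detour⇒cycle {Y} {x} d Yx = closeUp (proj₁ (simple⇒indexed (proj₂ (loop-erase walk))))
    where
    open Detour d
    closeUp : IndexedPath (λ v → Y v ≡ true × v ≢ x) start end → CycleIn K (tabulate Y)
    closeUp record { m = zero ; ws-first = ws-first ; ws-last = ws-last } =
      ⊥-elim (distinct (trans (sym ws-first) ws-last))
    closeUp record { m = suc k ; ws = ws ; ws-first = ws-first ; ws-last = ws-last
                   ; ws-injective = ws-injective ; ws-adj = ws-adj ; ws-ok = ws-ok } = record
      { k = k ; vs = vs ; inj = vs-injective ; inside = vs-inside ; edges = vs-adj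
      ; closing = subst (λ v → Adj K v x) (sym ws-last) leave }
      where
      vs : Fin (suc (suc (suc k))) → Fin (n K)
      vs zero    = x
      vs (suc i) = ws i
      vs-injective : Injective _≡_ _≡_ vs
      vs-injective {zero}  {zero}  _  = refl
      vs-injective {zero}  {suc j} eq = ⊥-elim (proj₂ (ws-ok j) (sym eq))
      vs-injective {suc i} {zero}  eq = ⊥-elim (proj₂ (ws-ok i) eq)
      vs-injective {suc i} {suc j} eq = cong suc (ws-injective eq)
      vs-inside : ∀ i → vs i ∈ tabulate Y
      vs-inside zero    = ∈-tabulate⁺ Y Yx
      vs-inside (suc i) = ∈-tabulate⁺ Y (proj₁ (ws-ok i))
      vs-adj : ∀ i → Adj K (vs (inject₁ i)) (vs (suc i))
      vs-adj zero    = subst (Adj K x) (sym ws-first) enter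
      vs-adj (suc i) = ws-adj i

pattern 0F = zero
pattern 1F = suc zero
pattern 2F = suc (suc zero)
pattern 3F = suc (suc (suc zero))

next prev opp : Fin 4 → Fin 4
next 0F = 1F
next 1F = 2F
next 2F = 3F
next 3F = 0F
prev 0F = 3F
prev 1F = 0F
prev 2F = 1F
prev 3F = 2F
opp 0F = 2F
opp 1F = 3F
opp 2F = 0F
opp 3F = 1F

c4adj-next : ∀ i → c4adj (next i) i ≡ true
c4adj-next 0F = refl
c4adj-next 1F = refl
c4adj-next 2F = refl
c4adj-next 3F = refl

c4adj-prev : ∀ i → c4adj (prev i) i ≡ true
c4adj-prev 0F = refl
c4adj-prev 1F = refl
c4adj-prev 2F = refl
c4adj-prev 3F = refl

c4adj-opp-next : ∀ i → c4adj (opp i) (next i) ≡ true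
c4adj-opp-next 0F = refl
c4adj-opp-next 1F = refl
c4adj-opp-next 2F = refl
c4adj-opp-next 3F = refl

c4adj-opp-prev : ∀ i → c4adj (opp i) (prev i) ≡ true
c4adj-opp-prev 0F = refl
c4adj-opp-prev 1F = refl
c4adj-opp-prev 2F = refl
c4adj-opp-prev 3F = refl

data Position (j i : Fin 4) : Set where
  same     : j ≡ i → Position j i
  adjacent : c4adj j i ≡ true → Position j i
  opposite : j ≡ opp i → Position j i

position : ∀ j i → Position j i
position 0F 0F = same refl
position 0F 1F = adjacent refl
position 0F 2F = opposite refl
position 0F 3F = adjacent refl
position 1F 0F = adjacent refl
position 1F 1F = same refl
position 1F 2F = adjacent refl
position 1F 3F = opposite refl
position 2F 0F = opposite refl
position 2F 1F = adjacent refl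
position 2F 2F = same refl
position 2F 3F = adjacent refl
position 3F 0F = adjacent refl
position 3F 1F = opposite refl
position 3F 2F = adjacent refl
position 3F 3F = same refl

c4adj-next-next : ∀ i j → c4adj (next i) (next j) ≡ c4adj i j
c4adj-next-next 0F 0F = refl
c4adj-next-next 0F 1F = refl
c4adj-next-next 0F 2F = refl
c4adj-next-next 0F 3F = refl
c4adj-next-next 1F 0F = refl
c4adj-next-next 1F 1F = refl
c4adj-next-next 1F 2F = refl
c4adj-next-next 1F 3F = refl
c4adj-next-next 2F 0F = refl
c4adj-next-next 2F 1F = refl
c4adj-next-next 2F 2F = refl
c4adj-next-next 2F 3F = refl
c4adj-next-next 3F 0F = refl
c4adj-next-next 3F 1F = refl
c4adj-next-next 3F 2F = refl
c4adj-next-next 3F 3F = refl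

next-prev : ∀ i → next (prev i) ≡ i
next-prev 0F = refl
next-prev 1F = refl
next-prev 2F = refl
next-prev 3F = refl

prev-next : ∀ i → prev (next i) ≡ i
prev-next 0F = refl
prev-next 1F = refl
prev-next 2F = refl
prev-next 3F = refl

¬¬-decide : ∀ {n} (P : Fin n → Set) → ¬ ¬ (∀ i → Dec (P i))
¬¬-decide P = sequence (RawMonad.rawApplicative ¬¬-Monad) (λ _ → ¬¬-excluded-middle)

rotateC4 : ∀ {G M} → InducedC4 G M → InducedC4 G M
rotateC4 (f , f-injective , f∈M , onto , f-adj) =
    f ∘ next
  , (λ eq → trans (sym (prev-next _)) (trans (cong prev (f-injective eq)) (prev-next _)))
  , f∈M ∘ next
  , (λ v v∈M → let i , fi≡v = onto v v∈M in prev i , trans (cong f (next-prev i)) fi≡v)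
  , (λ i j → trans (f-adj (next i) (next j)) (c4adj-next-next i j))

c4adj-colouring : ∀ i j → c4adj i j ≡ true → c4adj i 0F ≢ c4adj j 0F
c4adj-colouring 0F 0F ()
c4adj-colouring 0F 1F _ ()
c4adj-colouring 0F 2F ()
c4adj-colouring 0F 3F _ ()
c4adj-colouring 1F 0F _ ()
c4adj-colouring 1F 1F ()
c4adj-colouring 1F 2F _ ()
c4adj-colouring 1F 3F ()
c4adj-colouring 2F 0F ()
c4adj-colouring 2F 1F _ ()
c4adj-colouring 2F 2F ()
c4adj-colouring 2F 3F _ ()
c4adj-colouring 3F 0F _ ()
c4adj-colouring 3F 1F ()
c4adj-colouring 3F 2F _ ()
c4adj-colouring 3F 3F ()

InducedC4⇒InducedBipartite : ∀ {G M} → InducedC4 G M → InducedBipartite G M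
InducedC4⇒InducedBipartite {G} {M} (f , _ , _ , onto , f-adj) = (λ w → adj G w (f 0F)) , proper
  where
  proper : ∀ u v → u ∈ M → v ∈ M → adj G u v ≡ true → adj G u (f 0F) ≢ adj G v (f 0F)
  proper u v u∈M v∈M uv with i , refl ← onto u u∈M | j , refl ← onto v v∈M =
    λ eq → c4adj-colouring i j (trans (sym (f-adj i j)) uv) (trans (sym (f-adj i 0F)) (trans eq (f-adj j 0F)))


module Counting where

  open import Data.Nat.Properties using (+-*-semiring)
  open import Algebra.Properties.Semiring.Sum +-*-semiring public
    using (sum; sum-syntax; sum-cong-≗; ∑-distrib-+; ∑-comm; *-distribˡ-sum; *-distribʳ-sum)
  open import Data.Bool using (T; T?)
  open import Data.Fin.Properties using (toℕ-injective)
  open import Data.Fin.Subset.Properties using (_∈?_)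
  open import Data.List using (_++_; length; filter; concatMap; map; allFin) renaming (tabulate to tabulateˡ)
  open import Data.List.Properties using (length-++; filter-++; map-tabulate)
  open import Data.Nat using (_+_; _*_; _≤_; _<_; _<ᵇ_; z≤n; s≤s)
  open import Data.Nat.Properties using (+-identityʳ; *-identityʳ; m≤n⇒m≤1+n; <-cmp; <ᵇ⇒<; <⇒<ᵇ)
  open import Data.Unit using (tt)
  open import Function using (flip)
  open import Relation.Binary using (tri<; tri≈; tri>)

  𝟙 : Bool → ℕ
  𝟙 true  = 1
  𝟙 false = 0

  ∑-zero : ∀ n → ∑[ i < n ] 0 ≡ 0
  ∑-zero zero    = refl
  ∑-zero (suc n) = ∑-zero n

  ∑-one : ∀ n → ∑[ i < n ] 1 ≡ n
  ∑-one zero    = refl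
  ∑-one (suc n) = cong suc (∑-one n)

  ∑-select : ∀ {n} (w : Fin n) (φ : Fin n → ℕ) → ∑[ v < n ] (𝟙 (does (w ≟ v)) * φ v) ≡ φ w
  ∑-select {suc n} zero φ = begin
    φ zero + 0 + ∑[ v < n ] 0   ≡⟨ cong₂ _+_ (+-identityʳ (φ zero)) (∑-zero n) ⟩
    φ zero + 0                  ≡⟨ +-identityʳ (φ zero) ⟩
    φ zero                      ∎
    where open ≡-Reasoning
  ∑-select {suc n} (suc w) φ = begin
    ∑[ v < n ] (𝟙 (does (suc w ≟ suc v)) * φ (suc v))
      ≡⟨ sum-cong-≗ (λ v → cong (λ b → 𝟙 b * φ (suc v)) (does-suc≟suc v)) ⟩
    ∑[ v < n ] (𝟙 (does (w ≟ v)) * φ (suc v))          ≡⟨ ∑-select w (φ ∘ suc) ⟩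
    φ (suc w)                                           ∎
    where
    open ≡-Reasoning
    does-suc≟suc : ∀ v → does (suc w ≟ suc v) ≡ does (w ≟ v)
    does-suc≟suc v with w ≟ v
    ... | yes _ = refl
    ... | no  _ = refl

  ∑∑-distrib-+ : ∀ {m} (φ ψ : Fin m → Fin m → ℕ) →
    ∑[ u < m ] ∑[ v < m ] (φ u v + ψ u v) ≡ ∑[ u < m ] ∑[ v < m ] φ u v + ∑[ u < m ] ∑[ v < m ] ψ u v
  ∑∑-distrib-+ {m} φ ψ = trans (sum-cong-≗ (λ u → ∑-distrib-+ (φ u) (ψ u)))
                                (∑-distrib-+ (λ u → ∑[ v < m ] φ u v) (λ u → ∑[ v < m ] ψ u v))

  count : ∀ {n} → (Fin n → Bool) → ℕ
  count {n} P = ∑[ v < n ] 𝟙 (P v)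

  count≤ : ∀ {n} (P : Fin n → Bool) → count P ≤ n
  count≤ {zero}  P = z≤n
  count≤ {suc n} P with P zero
  ... | true  = s≤s (count≤ (P ∘ suc))
  ... | false = m≤n⇒m≤1+n (count≤ (P ∘ suc))

  count<  : ∀ {n} (P : Fin n → Bool) (v : Fin n) → P v ≡ false → count P < n
  count< {suc n} P zero    Pv≡false rewrite Pv≡false = s≤s (count≤ (P ∘ suc))
  count< {suc n} P (suc v) Pv≡false with P zero
  ... | true  = s≤s (count< (P ∘ suc) v Pv≡false)
  ... | false = m≤n⇒m≤1+n (count< (P ∘ suc) v Pv≡false)

  count-mono : ∀ {n} {P Q : Fin n → Bool} → (∀ v → P v ≡ true → Q v ≡ true) → count P ≤ count Q
  count-mono {zero}          P⊆Q = z≤n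
  count-mono {suc n} {P} {Q} P⊆Q with P zero in P0 | Q zero in Q0
  ... | true  | true  = s≤s (count-mono (P⊆Q ∘ suc))
  ... | true  | false with () ← trans (sym (P⊆Q zero P0)) Q0
  ... | false | true  = m≤n⇒m≤1+n (count-mono (P⊆Q ∘ suc))
  ... | false | false = count-mono (P⊆Q ∘ suc)

  enum : ∀ {n} (P : Fin n → Bool) → Fin (count P) → Fin n
  enum {suc n} P with P zero
  ... | true  = λ { zero → zero ; (suc k) → suc (enum (P ∘ suc) k) }
  ... | false = suc ∘ enum (P ∘ suc)

  enum-sound : ∀ {n} (P : Fin n → Bool) (k : Fin (count P)) → P (enum P k) ≡ true
  enum-sound {suc n} P k with P zero in P0
  enum-sound {suc n} P zero    | true  = P0
  enum-sound {suc n} P (suc k) | true  = enum-sound (P ∘ suc) k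
  enum-sound {suc n} P k       | false = enum-sound (P ∘ suc) k

  enum-injective : ∀ {n} (P : Fin n → Bool) {k l : Fin (count P)} → enum P k ≡ enum P l → k ≡ l
  enum-injective {suc n} P {k} {l} eq with P zero
  enum-injective {suc n} P {zero}  {zero}  eq | true  = refl
  enum-injective {suc n} P {suc k} {suc l} eq | true  = cong suc (enum-injective (P ∘ suc) (suc-injective eq))
  enum-injective {suc n} P {k}     {l}     eq | false = enum-injective (P ∘ suc) (suc-injective eq)

  enum-complete : ∀ {n} (P : Fin n → Bool) (v : Fin n) → P v ≡ true → Σ (Fin (count P)) λ k → enum P k ≡ v
  enum-complete {suc n} P v Pv with P zero in P0
  enum-complete {suc n} P zero    Pv | true  = zero , refl
  enum-complete {suc n} P (suc v) Pv | true  with k , refl ← enum-complete (P ∘ suc) v Pv = suc k , refl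
  enum-complete {suc n} P zero    Pv | false with () ← trans (sym Pv) P0
  enum-complete {suc n} P (suc v) Pv | false with k , refl ← enum-complete (P ∘ suc) v Pv = k , refl

  ∑-enum : ∀ {n} (P : Fin n → Bool) (φ : Fin n → ℕ) →
           ∑[ k < count P ] φ (enum P k) ≡ ∑[ v < n ] (𝟙 (P v) * φ v)
  ∑-enum {zero}  P φ = refl
  ∑-enum {suc n} P φ with P zero
  ... | true  = cong₂ _+_ (sym (+-identityʳ (φ zero))) (∑-enum (P ∘ suc) (φ ∘ suc))
  ... | false = ∑-enum (P ∘ suc) (φ ∘ suc)

  length-filter-tabulate : ∀ {A : Set} {n} (p : A → Bool) (t : Fin n → A) →
                           length (filter (T? ∘ p) (tabulateˡ t)) ≡ ∑[ i < n ] 𝟙 (p (t i))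
  length-filter-tabulate {n = zero}  p t = refl
  length-filter-tabulate {n = suc n} p t with p (t zero)
  ... | true  = cong suc (length-filter-tabulate p (t ∘ suc))
  ... | false = length-filter-tabulate p (t ∘ suc)

  length-filter-concatMap-tabulate :
    ∀ {A B : Set} {n} (p : A → Bool) (g : B → List A) (t : Fin n → B) →
    length (filter (T? ∘ p) (concatMap g (tabulateˡ t))) ≡ ∑[ i < n ] length (filter (T? ∘ p) (g (t i)))
  length-filter-concatMap-tabulate {n = zero}  p g t = refl
  length-filter-concatMap-tabulate {A} {n = suc n} p g t = begin
    length (filter (T? ∘ p) (g (t zero) ++ rest))                      ≡⟨ cong length (filter-++ (T? ∘ p) (g (t zero)) rest) ⟩
    length (filter (T? ∘ p) (g (t zero)) ++ filter (T? ∘ p) rest)      ≡⟨ length-++ (filter (T? ∘ p) (g (t zero))) ⟩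
    length (filter (T? ∘ p) (g (t zero))) + length (filter (T? ∘ p) rest)
      ≡⟨ cong (length (filter (T? ∘ p) (g (t zero))) +_) (length-filter-concatMap-tabulate p g (t ∘ suc)) ⟩
    ∑[ i < suc n ] length (filter (T? ∘ p) (g (t i)))                  ∎
    where
    open ≡-Reasoning
    rest : List A
    rest = concatMap g (tabulateˡ (t ∘ suc))

  <ᵇ-true : ∀ {m n} → m < n → (m <ᵇ n) ≡ true
  <ᵇ-true {m} {n} m<n with m <ᵇ n | <⇒<ᵇ m<n
  ... | true | _ = refl

  <ᵇ-false : ∀ {m n} → ¬ m < n → (m <ᵇ n) ≡ false
  <ᵇ-false {m} {n} m≮n with m <ᵇ n in eq
  ... | true  = ⊥-elim (m≮n (<ᵇ⇒< m n (subst T (sym eq) tt)))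
  ... | false = refl

  adjUp : (G : Graph) → Fin (n G) → Fin (n G) → Bool
  adjUp G i j = (toℕ i <ᵇ toℕ j) ∧ adj G i j

  edgeCount≡∑adjUp : (G : Graph) → edgeCount G ≡ ∑[ i < n G ] ∑[ j < n G ] 𝟙 (adjUp G i j)
  edgeCount≡∑adjUp G = begin
    edgeCount G
      ≡⟨ length-filter-concatMap-tabulate isEdge (λ i → map (i ,_) (allFin (n G))) id ⟩
    ∑[ i < n G ] length (filter (T? ∘ isEdge) (map (i ,_) (allFin (n G))))
      ≡⟨ sum-cong-≗ (λ i → cong (length ∘ filter (T? ∘ isEdge)) (map-tabulate id (i ,_))) ⟩
    ∑[ i < n G ] length (filter (T? ∘ isEdge) (tabulateˡ (i ,_)))
      ≡⟨ sum-cong-≗ (λ i → length-filter-tabulate isEdge (i ,_)) ⟩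
    ∑[ i < n G ] ∑[ j < n G ] 𝟙 (adjUp G i j)
      ∎
    where
    open ≡-Reasoning
    isEdge : Fin (n G) × Fin (n G) → Bool
    isEdge (i , j) = adjUp G i j

  degreeSum : Graph → ℕ
  degreeSum G = ∑[ i < n G ] ∑[ j < n G ] 𝟙 (adj G i j)

  𝟙-adj≡adjUp+adjDown : (G : Graph) (i j : Fin (n G)) → 𝟙 (adj G i j) ≡ 𝟙 (adjUp G i j) + 𝟙 (adjUp G j i)
  𝟙-adj≡adjUp+adjDown G i j with <-cmp (toℕ i) (toℕ j)
  ... | tri< i<j _ j≮i rewrite <ᵇ-true i<j | <ᵇ-false j≮i = sym (+-identityʳ _)
  ... | tri> i≮j _ j<i rewrite <ᵇ-true j<i | <ᵇ-false i≮j = cong 𝟙 (adj-sym G i j)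
  ... | tri≈ i≮j i≡j _ with refl ← toℕ-injective i≡j rewrite <ᵇ-false i≮j | adj-irrefl G i = refl

  handshake : (G : Graph) → degreeSum G ≡ edgeCount G + edgeCount G
  handshake G = begin
    ∑[ i < n G ] ∑[ j < n G ] 𝟙 (adj G i j)
      ≡⟨ sum-cong-≗ (λ i → trans (sum-cong-≗ (𝟙-adj≡adjUp+adjDown G i)) (∑-distrib-+ (up i) (flip up i))) ⟩
    ∑[ i < n G ] (∑[ j < n G ] up i j + ∑[ j < n G ] up j i)
      ≡⟨ ∑-distrib-+ (λ i → ∑[ j < n G ] up i j) (λ i → ∑[ j < n G ] up j i) ⟩
    ∑[ i < n G ] ∑[ j < n G ] up i j + ∑[ i < n G ] ∑[ j < n G ] up j i
      ≡⟨ cong (∑[ i < n G ] ∑[ j < n G ] up i j +_) (∑-comm (flip up)) ⟩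
    ∑[ i < n G ] ∑[ j < n G ] up i j + ∑[ j < n G ] ∑[ i < n G ] up j i
      ≡⟨ cong₂ _+_ (sym (edgeCount≡∑adjUp G)) (sym (edgeCount≡∑adjUp G)) ⟩
    edgeCount G + edgeCount G
      ∎
    where
    open ≡-Reasoning
    up : Fin (n G) → Fin (n G) → ℕ
    up i j = 𝟙 (adjUp G i j)

  does-≟-sym : ∀ {m} (i j : Fin m) → does (i ≟ j) ≡ does (j ≟ i)
  does-≟-sym i j with i ≟ j | j ≟ i
  ... | yes _    | yes _    = refl
  ... | no _     | no _     = refl
  ... | yes refl | no i≢i   = ⊥-elim (i≢i refl)
  ... | no i≢i   | yes refl = ⊥-elim (i≢i refl)

  module _ {k n} (f : Fin k → Fin n) (f-injective : Injective _≡_ _≡_ f) where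

    does-≟-injective : ∀ i j → does (f i ≟ f j) ≡ does (i ≟ j)
    does-≟-injective i j with i ≟ j | f i ≟ f j
    ... | yes refl | yes _    = refl
    ... | yes refl | no fi≢fi = ⊥-elim (fi≢fi refl)
    ... | no _     | no _     = refl
    ... | no i≢j   | yes fi≡fj = ⊥-elim (i≢j (f-injective fi≡fj))

    module _ (P : Fin n → Bool) (P-image : ∀ i → P (f i) ≡ true)
             (P⇒image : ∀ {v} → P v ≡ true → Σ (Fin k) λ i → f i ≡ v) where

      𝟙-image : ∀ v → 𝟙 (P v) ≡ ∑[ i < k ] 𝟙 (does (f i ≟ v))
      𝟙-image v with P v in Pv
      ... | true with j , refl ← P⇒image Pv = sym (begin
        ∑[ i < k ] 𝟙 (does (f i ≟ f j))       ≡⟨ sum-cong-≗ (λ i → cong 𝟙 (trans (does-≟-injective i j) (does-≟-sym i j))) ⟩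
        ∑[ i < k ] 𝟙 (does (j ≟ i))           ≡⟨ sum-cong-≗ (λ i → sym (*-identityʳ (𝟙 (does (j ≟ i))))) ⟩
        ∑[ i < k ] (𝟙 (does (j ≟ i)) * 1)     ≡⟨ ∑-select j (λ _ → 1) ⟩
        1                                     ∎)
        where open ≡-Reasoning
      ... | false = sym (trans (sum-cong-≗ not-image) (∑-zero k))
        where
        not-image : ∀ i → 𝟙 (does (f i ≟ v)) ≡ 0
        not-image i with f i ≟ v
        ... | no _     = refl
        ... | yes refl with () ← trans (sym (P-image i)) Pv

      ∑-image : ∀ (φ : Fin n → ℕ) → ∑[ v < n ] (𝟙 (P v) * φ v) ≡ ∑[ i < k ] φ (f i)
      ∑-image φ = begin
        ∑[ v < n ] (𝟙 (P v) * φ v)                           ≡⟨ sum-cong-≗ (λ v → cong (_* φ v) (𝟙-image v)) ⟩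
        ∑[ v < n ] (∑[ i < k ] 𝟙 (does (f i ≟ v)) * φ v)     ≡⟨ sum-cong-≗ (λ v → *-distribʳ-sum (φ v) (λ i → 𝟙 (does (f i ≟ v)))) ⟩
        ∑[ v < n ] ∑[ i < k ] (𝟙 (does (f i ≟ v)) * φ v)     ≡⟨ ∑-comm (λ v i → 𝟙 (does (f i ≟ v)) * φ v) ⟩
        ∑[ i < k ] ∑[ v < n ] (𝟙 (does (f i ≟ v)) * φ v)     ≡⟨ sum-cong-≗ (λ i → ∑-select (f i) φ) ⟩
        ∑[ i < k ] φ (f i)                                   ∎
        where open ≡-Reasoning

      count-image : count P ≡ k
      count-image = begin
        count P                          ≡⟨ sum-cong-≗ (λ v → sym (*-identityʳ (𝟙 (P v)))) ⟩
        ∑[ v < n ] (𝟙 (P v) * 1)         ≡⟨ ∑-image (λ _ → 1) ⟩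
        ∑[ i < k ] 1                     ≡⟨ ∑-one k ⟩
        k                                ∎
        where open ≡-Reasoning

  induced : (G : Graph) → (Fin (n G) → Bool) → Graph
  induced G P = record
    { n      = count P
    ; adj    = λ k l → adj G (enum P k) (enum P l)
    ; sym    = λ k l → adj-sym G (enum P k) (enum P l)
    ; irrefl = λ k → adj-irrefl G (enum P k)
    }

  degreeSum-induced : (G : Graph) (P : Fin (n G) → Bool) →
    degreeSum (induced G P) ≡ ∑[ u < n G ] ∑[ v < n G ] (𝟙 (P u) * (𝟙 (P v) * 𝟙 (adj G u v)))
  degreeSum-induced G P = begin
    ∑[ k < count P ] ∑[ l < count P ] 𝟙 (adj G (enum P k) (enum P l))
      ≡⟨ sum-cong-≗ (λ k → ∑-enum P (λ v → 𝟙 (adj G (enum P k) v))) ⟩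
    ∑[ k < count P ] ∑[ v < n G ] (𝟙 (P v) * 𝟙 (adj G (enum P k) v))
      ≡⟨ ∑-enum P (λ u → ∑[ v < n G ] (𝟙 (P v) * 𝟙 (adj G u v))) ⟩
    ∑[ u < n G ] (𝟙 (P u) * ∑[ v < n G ] (𝟙 (P v) * 𝟙 (adj G u v)))
      ≡⟨ sum-cong-≗ (λ u → *-distribˡ-sum (𝟙 (P u)) (λ v → 𝟙 (P v) * 𝟙 (adj G u v))) ⟩
    ∑[ u < n G ] ∑[ v < n G ] (𝟙 (P u) * (𝟙 (P v) * 𝟙 (adj G u v)))
      ∎
    where open ≡-Reasoning

  module InducedImage (G : Graph) (P : Fin (n G) → Bool) (X : Subset (count P)) where

    image : Fin (n G) → Bool
    image v = does (any? λ k → (enum P k ≟ v) ×-dec (k ∈? X))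

    image⁺ : ∀ {k} → k ∈ X → image (enum P k) ≡ true
    image⁺ {k} k∈X with any? (λ l → (enum P l ≟ enum P k) ×-dec (l ∈? X))
    ... | yes _ = refl
    ... | no ∄ = ⊥-elim (∄ (k , refl , k∈X))

    image⁻ : ∀ {v} → image v ≡ true → Σ (Fin (count P)) λ k → enum P k ≡ v × k ∈ X
    image⁻ {v} eq with any? (λ k → (enum P k ≟ v) ×-dec (k ∈? X))
    ... | yes p = p

    image⊆P : ∀ {v} → image v ≡ true → P v ≡ true
    image⊆P eq with k , refl , _ ← image⁻ eq = enum-sound P k

    ∉-image⁺ : ∀ {k} → k ∉ X → image (enum P k) ≡ false
    ∉-image⁺ {k} k∉X with image (enum P k) in eq
    ... | false = refl
    ... | true with l , l↦k , l∈X ← image⁻ eq rewrite enum-injective P l↦k = ⊥-elim (k∉X l∈X)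

    ∉-image⁻ : ∀ {k} → image (enum P k) ≡ false → k ∉ X
    ∉-image⁻ eq k∈X with () ← trans (sym (image⁺ k∈X)) eq

    CycleIn-image⇒CycleIn-induced : CycleIn G (tabulate image) → CycleIn (induced G P) X
    CycleIn-image⇒CycleIn-induced c = record
      { k = k ; vs = proj₁ ∘ preimage ; inj = inj′ ; inside = proj₂ ∘ proj₂ ∘ preimage
      ; edges = λ i → subst₂ (Adj G) (sym (enum-preimage (inject₁ i))) (sym (enum-preimage (suc i))) (edges i)
      ; closing = subst₂ (Adj G) (sym (enum-preimage _)) (sym (enum-preimage zero)) closing }
      where
      open CycleIn c
      preimage : ∀ i → Σ (Fin (count P)) λ l → enum P l ≡ vs i × l ∈ X
      preimage i = image⁻ (∈-tabulate⁻ image (inside i))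
      enum-preimage : ∀ i → enum P (proj₁ (preimage i)) ≡ vs i
      enum-preimage = proj₁ ∘ proj₂ ∘ preimage
      inj′ : Injective _≡_ _≡_ (proj₁ ∘ preimage)
      inj′ {i} {j} eq = inj (trans (sym (enum-preimage i)) (trans (cong (enum P) eq) (enum-preimage j)))

module Parts (G : Graph) (inM : Fin (n G) → Bool) where

  open import Data.Nat using (_+_; _*_)
  open import Data.Nat.Tactic.RingSolver using (solve-∀)
  open Counting


  private
    V : Set
    V = Fin (n G)

  record Side : Set where
    field
      member : V → Bool
      closed : ∀ {x y} → inM x ≡ false → member x ≡ true → Adj G x y → inM y ≡ false → member y ≡ true
  open Side public

  complement : Side → Side
  complement s = record { member = not ∘ member s ; closed = closedᶜ }
    where
    closedᶜ : ∀ {x y} → inM x ≡ false → not (member s x) ≡ true → Adj G x y → inM y ≡ false →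
              not (member s y) ≡ true
    closedᶜ {x} {y} x∉M x∉s xy y∉M with member s y in y∈s
    ... | false = refl
    ... | true with member s x | closed s y∉M y∈s (Adj-sym G xy) x∉M
    ...   | false | ()
    ...   | true  | _ with () ← x∉s

  part : Side → V → Bool
  part s v = inM v ∨ member s v

  inM⇒part : ∀ s {v} → inM v ≡ true → part s v ≡ true
  inM⇒part s v∈M rewrite v∈M = refl

  member⇒part : ∀ s {v} → member s v ≡ true → part s v ≡ true
  member⇒part s {v} v∈s rewrite v∈s = ∨-zeroʳ (inM v)

  part⇒member : ∀ s {v} → part s v ≡ true → inM v ≡ false → member s v ≡ true
  part⇒member s v∈part v∉M rewrite v∉M = v∈part

  partGraph : Side → EdgeSet (n G) → Graph
  partGraph s X = induced (G ∪ᴱ X) (part s)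

  WalkOutside : EdgeSet (n G) → Side → (V → Bool) → V → V → Set
  WalkOutside X s Y = Walk (Adj (G ∪ᴱ X)) (λ v → part s v ≡ true × Y v ≡ false)

  record ForestSeparator (X : EdgeSet (n G)) (s : Side) (a b c d : V) : Set where
    field
      Y         : V → Bool
      Y⊆part    : ∀ {v} → Y v ≡ true → part s v ≡ true
      a∈Y       : Y a ≡ true
      c∈Y       : Y c ≡ true
      b∉Y       : Y b ≡ false
      d∉Y       : Y d ≡ false
      forest    : ¬ CycleIn (G ∪ᴱ X) (tabulate Y)
      separates : ¬ WalkOutside X s Y b d

  weaken : ∀ {X s a b c d} → ForestSeparator X s a b c d → ForestSeparator ∅ᴱ s a b c d
  weaken {X} S = record
    { Y = Y ; Y⊆part = Y⊆part ; a∈Y = a∈Y ; c∈Y = c∈Y ; b∉Y = b∉Y ; d∉Y = d∉Y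
    ; forest    = forest ∘ CycleIn-∪ᴱ G X ∘ CycleIn-∪∅ᴱ⁻ G
    ; separates = separates ∘ mapʷ (Adj-∪ᴱ⁺ G X ∘ Adj-∪∅ᴱ⁻ G) id
    }
    where open ForestSeparator S

  separator-nonadjacent : ∀ {X s a b c d} → ForestSeparator X s a b c d →
                          inM b ≡ true → inM d ≡ true → ¬ Adj (G ∪ᴱ X) b d
  separator-nonadjacent {s = s} S b∈M d∈M bd =
    separates (step (inM⇒part s b∈M , b∉Y) bd (here (inM⇒part s d∈M , d∉Y)))
    where open ForestSeparator S

  SupportedOnM : EdgeSet (n G) → Set
  SupportedOnM X = ∀ {u v} → edge X u v ≡ true → inM u ≡ true × inM v ≡ true

  count-parts : (s : Side) → count (part s) + count (part (complement s)) ≡ n G + count inM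
  count-parts s = begin
    count (part s) + count (part (complement s))          ≡⟨ ∑-distrib-+ (𝟙 ∘ part s) (𝟙 ∘ part (complement s)) ⟨
    ∑[ v < n G ] (𝟙 (part s v) + 𝟙 (part (complement s) v)) ≡⟨ sum-cong-≗ pointwise ⟩
    ∑[ v < n G ] (1 + 𝟙 (inM v))                           ≡⟨ ∑-distrib-+ (λ _ → 1) (𝟙 ∘ inM) ⟩
    ∑[ v < n G ] 1 + count inM                             ≡⟨ cong (_+ count inM) (∑-one (n G)) ⟩
    n G + count inM                                        ∎
    where
    open ≡-Reasoning
    pointwise : ∀ v → 𝟙 (part s v) + 𝟙 (part (complement s) v) ≡ 1 + 𝟙 (inM v)
    pointwise v with inM v | member s v
    ... | true  | _     = refl
    ... | false | true  = refl
    ... | false | false = refl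

  edge-outsideˡ : ∀ (Z : EdgeSet (n G)) → SupportedOnM Z → ∀ {u v} → inM u ≡ false → edge Z u v ≡ false
  edge-outsideˡ Z Z⊆M {u} {v} u∉M with edge Z u v in uv
  ... | false = refl
  ... | true with () ← trans (sym (proj₁ (Z⊆M uv))) u∉M

  edge-outsideʳ : ∀ (Z : EdgeSet (n G)) → SupportedOnM Z → ∀ {u v} → inM v ≡ false → edge Z u v ≡ false
  edge-outsideʳ Z Z⊆M {u} {v} v∉M with edge Z u v in uv
  ... | false = refl
  ... | true with () ← trans (sym (proj₂ (Z⊆M uv))) v∉M

  private
    glue-pointwise-bool : ∀ mu mv su sv a x y → (mu ∧ mv ≡ false → x ≡ false × y ≡ false) →
      (mu ≡ false → mv ≡ false → a ≡ true → su ≡ sv) →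
      𝟙 (mu ∨ su) * (𝟙 (mv ∨ sv) * 𝟙 (a ∨ x)) + 𝟙 (mu ∨ not su) * (𝟙 (mv ∨ not sv) * 𝟙 (a ∨ y))
        + 𝟙 mu * (𝟙 mv * 𝟙 a)
      ≡ 𝟙 a + (𝟙 mu * (𝟙 mv * 𝟙 (a ∨ x)) + 𝟙 mu * (𝟙 mv * 𝟙 (a ∨ y)))
    glue-pointwise-bool true  true  _  _  a x y _ _ = rotate-summands (𝟙 (a ∨ x)) (𝟙 (a ∨ y)) (𝟙 a)
      where
      rotate-summands : ∀ p q r → 1 * (1 * p) + 1 * (1 * q) + 1 * (1 * r) ≡ r + (1 * (1 * p) + 1 * (1 * q))
      rotate-summands = solve-∀
    glue-pointwise-bool true  false _  sv a x y off _ with refl , refl ← off refl with sv | a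
    ... | true  | true  = refl
    ... | true  | false = refl
    ... | false | true  = refl
    ... | false | false = refl
    glue-pointwise-bool false true  su _  a x y off _ with refl , refl ← off refl with su | a
    ... | true  | true  = refl
    ... | true  | false = refl
    ... | false | true  = refl
    ... | false | false = refl
    glue-pointwise-bool false false su sv false x y off _ with refl , refl ← off refl with su | sv
    ... | true  | true  = refl
    ... | true  | false = refl
    ... | false | true  = refl
    ... | false | false = refl
    glue-pointwise-bool false false su sv true x y off same-side
      with refl , refl ← off refl | refl ← same-side refl refl refl with su
    ... | true  = refl
    ... | false = refl

  module _ (s : Side) (X Y : EdgeSet (n G)) (X⊆M : SupportedOnM X) (Y⊆M : SupportedOnM Y) where

    private
      sᶜ : Side
      sᶜ = complement s
      ΣΣ : (V → V → ℕ) → ℕ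
      ΣΣ φ = ∑[ u < n G ] ∑[ v < n G ] φ u v
      onM : (V → V → Bool) → V → V → ℕ
      onM a u v = 𝟙 (inM u) * (𝟙 (inM v) * 𝟙 (a u v))
      onPart : Side → (V → V → Bool) → V → V → ℕ
      onPart t a u v = 𝟙 (part t u) * (𝟙 (part t v) * 𝟙 (a u v))

    -- Off M × M both parts see exactly the edges of G, and an edge of G never joins s \ M to sᶜ \ M.
    glue-pointwise : ∀ u v →
      onPart s (adj (G ∪ᴱ X)) u v + onPart sᶜ (adj (G ∪ᴱ Y)) u v + onM (adj G) u v
      ≡ 𝟙 (adj G u v) + (onM (adj (G ∪ᴱ X)) u v + onM (adj (G ∪ᴱ Y)) u v)
    glue-pointwise u v =
      glue-pointwise-bool (inM u) (inM v) (member s u) (member s v) (adj G u v) _ _ off-M same-side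
      where
      off-M : inM u ∧ inM v ≡ false → edge X u v ≡ false × edge Y u v ≡ false
      off-M _ with inM u in Mu | inM v in Mv
      ... | false | _     = edge-outsideˡ X X⊆M Mu , edge-outsideˡ Y Y⊆M Mu
      ... | true  | false = edge-outsideʳ X X⊆M Mv , edge-outsideʳ Y Y⊆M Mv
      same-side : inM u ≡ false → inM v ≡ false → adj G u v ≡ true → member s u ≡ member s v
      same-side u∉M v∉M uv with member s u in su | member s v in sv
      ... | true  | true  = refl
      ... | false | false = refl
      ... | true  | false with () ← trans (sym (closed s u∉M su uv v∉M)) sv
      ... | false | true  with () ← trans (sym (closed s v∉M sv (Adj-sym G uv) u∉M)) su

    degreeSum-parts :
      degreeSum (partGraph s X) + degreeSum (partGraph sᶜ Y) + degreeSum (induced G inM)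
      ≡ degreeSum G + (degreeSum (induced (G ∪ᴱ X) inM) + degreeSum (induced (G ∪ᴱ Y) inM))
    degreeSum-parts = begin
      degreeSum (partGraph s X) + degreeSum (partGraph sᶜ Y) + degreeSum (induced G inM)
        ≡⟨ cong₂ _+_ (cong₂ _+_ (degreeSum-induced (G ∪ᴱ X) (part s)) (degreeSum-induced (G ∪ᴱ Y) (part sᶜ)))
                     (degreeSum-induced G inM) ⟩
      ΣΣ (onPart s (adj (G ∪ᴱ X))) + ΣΣ (onPart sᶜ (adj (G ∪ᴱ Y))) + ΣΣ (onM (adj G))
        ≡⟨ cong (_+ ΣΣ (onM (adj G))) (∑∑-distrib-+ (onPart s (adj (G ∪ᴱ X))) (onPart sᶜ (adj (G ∪ᴱ Y)))) ⟨
      ΣΣ (λ u v → onPart s (adj (G ∪ᴱ X)) u v + onPart sᶜ (adj (G ∪ᴱ Y)) u v) + ΣΣ (onM (adj G))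
        ≡⟨ ∑∑-distrib-+ _ (onM (adj G)) ⟨
      ΣΣ (λ u v → onPart s (adj (G ∪ᴱ X)) u v + onPart sᶜ (adj (G ∪ᴱ Y)) u v + onM (adj G) u v)
        ≡⟨ sum-cong-≗ (λ u → sum-cong-≗ (glue-pointwise u)) ⟩
      ΣΣ (λ u v → 𝟙 (adj G u v) + (onM (adj (G ∪ᴱ X)) u v + onM (adj (G ∪ᴱ Y)) u v))
        ≡⟨ ∑∑-distrib-+ (λ u v → 𝟙 (adj G u v)) _ ⟩
      degreeSum G + ΣΣ (λ u v → onM (adj (G ∪ᴱ X)) u v + onM (adj (G ∪ᴱ Y)) u v)
        ≡⟨ cong (degreeSum G +_) (∑∑-distrib-+ (onM (adj (G ∪ᴱ X))) (onM (adj (G ∪ᴱ Y)))) ⟩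
      degreeSum G + (ΣΣ (onM (adj (G ∪ᴱ X))) + ΣΣ (onM (adj (G ∪ᴱ Y))))
        ≡⟨ cong (degreeSum G +_) (cong₂ _+_ (degreeSum-induced (G ∪ᴱ X) inM) (degreeSum-induced (G ∪ᴱ Y) inM)) ⟨
      degreeSum G + (degreeSum (induced (G ∪ᴱ X) inM) + degreeSum (induced (G ∪ᴱ Y) inM))
        ∎
      where open ≡-Reasoning

module C4Cut (G : Graph) (M : Subset (n G)) (C : InducedC4 G M) (noForestCut : HasNoΨCut 𝔉 G) where

  open import Data.Nat using (_+_; _*_)
  open import Data.Nat.Properties using (*-cancelˡ-≡; +-cancelʳ-≡)
  open import Data.Nat.Tactic.RingSolver using (solve-∀)
  open Counting

  private
    V : Set
    V = Fin (n G)

  f : Fin 4 → V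
  f = proj₁ C

  f-injective : Injective _≡_ _≡_ f
  f-injective = proj₁ (proj₂ C)

  f-adj : ∀ i j → adj G (f i) (f j) ≡ c4adj i j
  f-adj = proj₂ (proj₂ (proj₂ (proj₂ C)))

  inM : V → Bool
  inM = lookup M

  open Parts G inM public

  inM-f : ∀ i → inM (f i) ≡ true
  inM-f i = []=⇒lookup (proj₁ (proj₂ (proj₂ C)) i)

  inM⇒f : ∀ {v} → inM v ≡ true → Σ (Fin 4) λ i → f i ≡ v
  inM⇒f {v} v∈M = proj₁ (proj₂ (proj₂ (proj₂ C))) v (lookup⇒[]= v M v∈M)

  part-f : ∀ s i → part s (f i) ≡ true
  part-f s i = inM⇒part s (inM-f i)

  c4-cycle : ∀ {Y : Subset (n G)} → (∀ i → f i ∈ Y) → CycleIn G Y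
  c4-cycle f∈Y = record
    { k = 1 ; vs = f ; inj = f-injective ; inside = f∈Y ; closing = f-adj 3F 0F ; edges = c4-edges }
    where
    c4-edges : ∀ i → adj G (f (inject₁ i)) (f (suc i)) ≡ true
    c4-edges 0F = f-adj 0F 1F
    c4-edges 1F = f-adj 1F 2F
    c4-edges 2F = f-adj 2F 3F

  diagonal antidiagonal : EdgeSet (n G)
  diagonal     = pairEdge (f 0F) (f 2F) (λ eq → 0≢2 (f-injective eq))
    where
    0≢2 : 0F ≢ 2F
    0≢2 ()
  antidiagonal = pairEdge (f 1F) (f 3F) (λ eq → 1≢3 (f-injective eq))
    where
    1≢3 : 1F ≢ 3F
    1≢3 ()

  count-M : count inM ≡ 4
  count-M = count-image f f-injective inM inM-f inM⇒f

  degreeOnM : EdgeSet (n G) → ℕ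
  degreeOnM X = ∑[ i < 4 ] ∑[ j < 4 ] 𝟙 (adj (G ∪ᴱ X) (f i) (f j))

  ∑∑-onM : ∀ (a : V → V → Bool) →
           ∑[ u < n G ] ∑[ v < n G ] (𝟙 (inM u) * (𝟙 (inM v) * 𝟙 (a u v)))
           ≡ ∑[ i < 4 ] ∑[ j < 4 ] 𝟙 (a (f i) (f j))
  ∑∑-onM a = begin
    ∑[ u < n G ] ∑[ v < n G ] (𝟙 (inM u) * (𝟙 (inM v) * 𝟙 (a u v)))
      ≡⟨ sum-cong-≗ (λ u → *-distribˡ-sum (𝟙 (inM u)) (λ v → 𝟙 (inM v) * 𝟙 (a u v))) ⟨
    ∑[ u < n G ] (𝟙 (inM u) * ∑[ v < n G ] (𝟙 (inM v) * 𝟙 (a u v)))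
      ≡⟨ ∑-image f f-injective inM inM-f inM⇒f (λ u → ∑[ v < n G ] (𝟙 (inM v) * 𝟙 (a u v))) ⟩
    ∑[ i < 4 ] ∑[ v < n G ] (𝟙 (inM v) * 𝟙 (a (f i) v))
      ≡⟨ sum-cong-≗ (λ i → ∑-image f f-injective inM inM-f inM⇒f (λ v → 𝟙 (a (f i) v))) ⟩
    ∑[ i < 4 ] ∑[ j < 4 ] 𝟙 (a (f i) (f j))
      ∎
    where open ≡-Reasoning

  degreeOnM-G : ∑[ i < 4 ] ∑[ j < 4 ] 𝟙 (adj G (f i) (f j)) ≡ 8
  degreeOnM-G = sum-cong-≗ (λ i → sum-cong-≗ (λ j → cong 𝟙 (f-adj i j)))

  isPair-f : ∀ p q i j → isPair (f p) (f q) (f i) (f j) ≡ isPair p q i j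
  isPair-f p q i j rewrite does-≟-injective f f-injective i p | does-≟-injective f f-injective j q
                         | does-≟-injective f f-injective i q | does-≟-injective f f-injective j p = refl

  degreeOnM-∅ : degreeOnM ∅ᴱ ≡ 8
  degreeOnM-∅ = sum-cong-≗ (λ i → sum-cong-≗ (λ j → cong 𝟙 (trans (∨-identityʳ _) (f-adj i j))))

  degreeOnM-diagonal : degreeOnM diagonal ≡ 10
  degreeOnM-diagonal =
    sum-cong-≗ (λ i → sum-cong-≗ (λ j → cong 𝟙 (cong₂ _∨_ (f-adj i j) (isPair-f 0F 2F i j))))

  degreeOnM-antidiagonal : degreeOnM antidiagonal ≡ 10
  degreeOnM-antidiagonal =
    sum-cong-≗ (λ i → sum-cong-≗ (λ j → cong 𝟙 (cong₂ _∨_ (f-adj i j) (isPair-f 1F 3F i j))))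

  degreeOnM-both : degreeOnM (diagonal ∪ˢ antidiagonal) ≡ 12
  degreeOnM-both = sum-cong-≗ (λ i → sum-cong-≗ (λ j →
    cong 𝟙 (cong₂ _∨_ (f-adj i j) (cong₂ _∨_ (isPair-f 0F 2F i j) (isPair-f 1F 3F i j)))))

  isPair-supported : ∀ p q {u v} → isPair (f p) (f q) u v ≡ true → inM u ≡ true × inM v ≡ true
  isPair-supported p q {u} {v} uv with isPair⁻ {p = f p} {f q} {u} {v} uv
  ... | inj₁ (refl , refl) = inM-f p , inM-f q
  ... | inj₂ (refl , refl) = inM-f q , inM-f p

  diagonal-supported : SupportedOnM diagonal
  diagonal-supported = isPair-supported 0F 2F

  antidiagonal-supported : SupportedOnM antidiagonal
  antidiagonal-supported = isPair-supported 1F 3F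

  both-supported : SupportedOnM (diagonal ∪ˢ antidiagonal)
  both-supported {u} {v} uv with isPair (f 0F) (f 2F) u v in on-diagonal
  ... | true  = diagonal-supported on-diagonal
  ... | false = antidiagonal-supported uv

  degreeSum-onM : ∀ X → degreeSum (induced (G ∪ᴱ X) inM) ≡ degreeOnM X
  degreeSum-onM X = trans (degreeSum-induced (G ∪ᴱ X) inM) (∑∑-onM (adj (G ∪ᴱ X)))

  edgeCount-parts : ∀ s X Y → SupportedOnM X → SupportedOnM Y → degreeOnM X + degreeOnM Y ≡ 20 →
                    edgeCount (partGraph s X) + edgeCount (partGraph (complement s) Y) ≡ edgeCount G + 6
  edgeCount-parts s X Y X⊆M Y⊆M degrees = halve {eA} {eB} {edgeCount G} (begin
    eA + eA + (eB + eB) + 8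
      ≡⟨ cong₂ _+_ (cong₂ _+_ (handshake (partGraph s X)) (handshake (partGraph (complement s) Y)))
                   (trans (degreeSum-induced G inM) (trans (∑∑-onM (adj G)) degreeOnM-G)) ⟨
    degreeSum (partGraph s X) + degreeSum (partGraph (complement s) Y) + degreeSum (induced G inM)
      ≡⟨ degreeSum-parts s X Y X⊆M Y⊆M ⟩
    degreeSum G + (degreeSum (induced (G ∪ᴱ X) inM) + degreeSum (induced (G ∪ᴱ Y) inM))
      ≡⟨ cong₂ _+_ (handshake G) (trans (cong₂ _+_ (degreeSum-onM X) (degreeSum-onM Y)) degrees) ⟩
    edgeCount G + edgeCount G + 20
      ∎)
    where
    open ≡-Reasoning
    eA eB : ℕ
    eA = edgeCount (partGraph s X)
    eB = edgeCount (partGraph (complement s) Y)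
    halve : ∀ {a b c} → a + a + (b + b) + 8 ≡ c + c + 20 → a + b ≡ c + 6
    halve {a} {b} {c} eq = *-cancelˡ-≡ (a + b) (c + 6) 2 (+-cancelʳ-≡ 8 _ _ (trans (lhs a b) (trans eq (rhs c))))
      where
      lhs : ∀ a b → 2 * (a + b) + 8 ≡ a + a + (b + b) + 8
      lhs = solve-∀
      rhs : ∀ c → c + c + 20 ≡ 2 * (c + 6) + 8
      rhs = solve-∀

  module ForestCut (s : Side) (X : EdgeSet (n G)) (Xs : Subset (count (part s)))
                   (cut : IsΨCut 𝔉 (partGraph s X) Xs) where

    open InducedImage (G ∪ᴱ X) (part s) Xs

    Conn : V → V → Set
    Conn = WalkOutside X s image

    image-forest : ¬ CycleIn (G ∪ᴱ X) (tabulate image)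
    image-forest = proj₂ cut ∘ CycleIn-image⇒CycleIn-induced

    lift : ∀ {x y} → Conn x y → ∀ k l → enum (part s) k ≡ x → enum (part s) l ≡ y →
           ConnAvoid (partGraph s X) Xs k l
    lift (here (_ , x∉)) k l refl l↦x rewrite enum-injective (part s) l↦x = here (∉-image⁻ x∉)
    lift (step {y = w} (_ , x∉) xw c) k l refl l↦y with kw , refl ← enum-complete (part s) w (proj₁ (source-ok c)) =
      step (∉-image⁻ x∉) xw (lift c kw l refl l↦y)

    step-member : ∀ {y w z} → member s y ≡ true → image y ≡ false → Adj G y w → Conn w z → Conn y z
    step-member y∈s y∉ yw = step (member⇒part s y∈s , y∉) (Adj-∪ᴱ⁺ G X yw)

    -- A walk of G − image leaving s \ M stays in s until it first meets M.
    reach-M : ∀ {y t} → Walk (Adj G) (λ v → image v ≡ false) y t → inM y ≡ false → member s y ≡ true →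
              inM t ≡ true → Σ V λ z → inM z ≡ true × image z ≡ false × Conn y z
    reach-M (here _) y∉M _ t∈M with () ← trans (sym t∈M) y∉M
    reach-M {y} (step {y = w} y∉ yw c) y∉M y∈s t∈M with inM w in w∈M
    ... | true  = w , w∈M , source-ok c , step-member y∈s y∉ yw (here (inM⇒part s w∈M , source-ok c))
    ... | false with z , z∈M , z∉ , cz ← reach-M c w∈M (closed s y∉M y∈s yw w∈M) t∈M =
      z , z∈M , z∉ , step-member y∈s y∉ yw cz

    ¬¬Conn-hub : ∀ {w₀} → inM w₀ ≡ true → image w₀ ≡ false →
                 (∀ {w} → inM w ≡ true → image w ≡ false → Conn w w₀) →
                 ∀ {y} → part s y ≡ true → image y ≡ false → ¬ ¬ Conn y w₀
    ¬¬Conn-hub {w₀} w₀∈M w₀∉ hub {y} y∈part y∉ ¬y~w₀ =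
      noForestCut (tabulate image)
        ((y , w₀ , ∉-tabulate⁺ image y∉ , ∉-tabulate⁺ image w₀∉ , separated) , image-forest ∘ CycleIn-∪ᴱ G X)
      where
      separated : ¬ ConnAvoid G (tabulate image) y w₀
      separated c with inM y in y∈M
      ... | true  = ¬y~w₀ (hub y∈M y∉)
      ... | false with z , z∈M , z∉ , y~z ← reach-M (ConnAvoid⇒Walk image c) y∈M y∈part w₀∈M =
        ¬y~w₀ (y~z ++ʷ hub z∈M z∉)

    -- If all of M − image is connected to one of its vertices, the cut of the part would be a cut of G.
    no-hub : ∀ {w₀} → inM w₀ ≡ true → image w₀ ≡ false →
             ¬ (∀ {w} → inM w ≡ true → image w ≡ false → Conn w w₀)
    no-hub w₀∈M w₀∉ hub with k , l , k∉ , l∉ , k≁l ← proj₁ cut =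
      ¬¬Conn-hub w₀∈M w₀∉ hub (enum-sound (part s) k) (∉-image⁺ k∉) λ k~w₀ →
      ¬¬Conn-hub w₀∈M w₀∉ hub (enum-sound (part s) l) (∉-image⁺ l∉) λ l~w₀ →
      k≁l (lift (k~w₀ ++ʷ reverseʷ (Adj-sym (G ∪ᴱ X)) l~w₀) k l refl refl)

    Out : Fin 4 → Set
    Out i = image (f i) ≡ false

    no-hub-at : ∀ i → Out i → ¬ (∀ j → Out j → Conn (f j) (f i))
    no-hub-at i oi conn = no-hub (inM-f i) oi conn′
      where
      conn′ : ∀ {w} → inM w ≡ true → image w ≡ false → Conn w (f i)
      conn′ w∈M w∉ with j , refl ← inM⇒f w∈M = conn j w∉

    edge-conn : ∀ {i j} → Out i → Out j → c4adj i j ≡ true → Conn (f i) (f j)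
    edge-conn {i} {j} oi oj i~j =
      step (part-f s i , oi) (Adj-∪ᴱ⁺ G X (trans (f-adj i j) i~j)) (here (part-f s j , oj))

    conn-around : ∀ i → Out i → (Out (opp i) → Conn (f (opp i)) (f i)) → ∀ j → Out j → Conn (f j) (f i)
    conn-around i oi via-opp j oj with position j i
    ... | same refl     = here (part-f s i , oi)
    ... | adjacent j~i  = edge-conn oj oi j~i
    ... | opposite refl = via-opp oj

    out⇒diagonal : ∀ i → Out i → image (f (next i)) ≡ true × image (f (prev i)) ≡ true × Out (opp i)
    out⇒diagonal i oi with image (f (next i)) in on | image (f (prev i)) in op | image (f (opp i)) in oo
    ... | true  | true  | false = refl , refl , refl
    ... | false | _     | _     = ⊥-elim (no-hub-at i oi (conn-around i oi λ oo →
                                    edge-conn oo on (c4adj-opp-next i) ++ʷ edge-conn on oi (c4adj-next i)))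
    ... | true  | false | _     = ⊥-elim (no-hub-at i oi (conn-around i oi λ oo →
                                    edge-conn oo op (c4adj-opp-prev i) ++ʷ edge-conn op oi (c4adj-prev i)))
    ... | true  | true  | true  =
      ⊥-elim (no-hub-at i oi (conn-around i oi λ o-opp → ⊥-elim (true≢false (trans (sym oo) o-opp))))

    diagonal-pattern : (Out 0F × image (f 1F) ≡ true × Out 2F × image (f 3F) ≡ true)
                     ⊎ (image (f 0F) ≡ true × Out 1F × image (f 2F) ≡ true × Out 3F)
    diagonal-pattern with image (f 0F) in o0
    ... | false with i1 , i3 , o2 ← out⇒diagonal 0F o0 = inj₁ (refl , i1 , o2 , i3)
    ... | true with image (f 1F) in o1
    ...   | false with i2 , _ , o3 ← out⇒diagonal 1F o1 = inj₂ (refl , refl , i2 , o3)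
    ...   | true with image (f 2F) in o2
    ...     | false with () ← trans (sym o0) (proj₂ (proj₂ (out⇒diagonal 2F o2)))
    ...     | true with image (f 3F) in o3
    ...       | false with () ← trans (sym o1) (proj₂ (proj₂ (out⇒diagonal 3F o3)))
    ...       | true = ⊥-elim (image-forest (CycleIn-∪ᴱ G X (c4-cycle (∈-tabulate⁺ image ∘ in-image))))
      where
      in-image : ∀ i → image (f i) ≡ true
      in-image 0F = o0
      in-image 1F = o1
      in-image 2F = o2
      in-image 3F = o3

    separator : ForestSeparator X s (f 0F) (f 1F) (f 2F) (f 3F) ⊎ ForestSeparator X s (f 1F) (f 2F) (f 3F) (f 0F)
    separator with diagonal-pattern
    ... | inj₁ (o0 , i1 , o2 , i3) = inj₂ record
      { Y = image ; Y⊆part = image⊆P ; a∈Y = i1 ; c∈Y = i3 ; b∉Y = o2 ; d∉Y = o0 ; forest = image-forest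
      ; separates = λ c → no-hub-at 0F o0 (conn-around 0F o0 λ _ → c) }
    ... | inj₂ (i0 , o1 , i2 , o3) = inj₁ record
      { Y = image ; Y⊆part = image⊆P ; a∈Y = i0 ; c∈Y = i2 ; b∉Y = o1 ; d∉Y = o3 ; forest = image-forest
      ; separates = λ c → no-hub-at 3F o3 (conn-around 3F o3 λ _ → c) }

  noForestCut-part : ∀ s X → ¬ ForestSeparator X s (f 0F) (f 1F) (f 2F) (f 3F) →
                     ¬ ForestSeparator X s (f 1F) (f 2F) (f 3F) (f 0F) → HasNoΨCut 𝔉 (partGraph s X)
  noForestCut-part s X ¬S ¬S′ Xs cut = [ ¬S , ¬S′ ] (ForestCut.separator s X Xs cut)

  noForestCut-diagonal : ∀ s → ¬ ForestSeparator diagonal s (f 0F) (f 1F) (f 2F) (f 3F) →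
                         HasNoΨCut 𝔉 (partGraph s diagonal)
  noForestCut-diagonal s ¬S = noForestCut-part s diagonal ¬S λ S′ →
    separator-nonadjacent S′ (inM-f 2F) (inM-f 0F) (Adj-∪ᴱ⁺ʳ G diagonal (isPair-qp (f 0F) (f 2F)))

  noForestCut-both : ∀ s → HasNoΨCut 𝔉 (partGraph s (diagonal ∪ˢ antidiagonal))
  noForestCut-both s = noForestCut-part s (diagonal ∪ˢ antidiagonal)
    (λ S → separator-nonadjacent S (inM-f 1F) (inM-f 3F) (Adj-∪ᴱ⁺ʳ G (diagonal ∪ˢ antidiagonal) f1~f3))
    (λ S → separator-nonadjacent S (inM-f 2F) (inM-f 0F) (Adj-∪ᴱ⁺ʳ G (diagonal ∪ˢ antidiagonal) f2~f0))
    where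
    f1~f3 : isPair (f 0F) (f 2F) (f 1F) (f 3F) ∨ isPair (f 1F) (f 3F) (f 1F) (f 3F) ≡ true
    f1~f3 = trans (cong (isPair (f 0F) (f 2F) (f 1F) (f 3F) ∨_) (isPair-pq (f 1F) (f 3F))) (∨-zeroʳ _)
    f2~f0 : isPair (f 0F) (f 2F) (f 2F) (f 0F) ∨ isPair (f 1F) (f 3F) (f 2F) (f 0F) ≡ true
    f2~f0 = cong (_∨ isPair (f 1F) (f 3F) (f 2F) (f 0F)) (isPair-qp (f 0F) (f 2F))

  private
    true-or-false : ∀ b → b ≡ true ⊎ b ≡ false
    true-or-false true  = inj₁ refl
    true-or-false false = inj₂ refl

    ∨-true-left : ∀ {a b} → a ∨ b ≡ true → b ≡ false → a ≡ true
    ∨-true-left {true}  _ _ = refl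
    ∨-true-left {false} a∨b b = trans (sym b) a∨b

  module Crossing (s t : Side) (complementary : ∀ {x} → inM x ≡ false → member t x ≡ not (member s x))
                  (S : ForestSeparator diagonal s (f 0F) (f 1F) (f 2F) (f 3F))
                  (T : ForestSeparator ∅ᴱ t (f 0F) (f 1F) (f 2F) (f 3F)) where

    module S = ForestSeparator S
    module T = ForestSeparator T

    Y : V → Bool
    Y v = S.Y v ∨ T.Y v

    Y∩M : ∀ {w} → inM w ≡ true → Y w ≡ true → w ≡ f 0F ⊎ w ≡ f 2F
    Y∩M w∈M Yw with inM⇒f w∈M
    ... | 0F , refl = inj₁ refl
    ... | 2F , refl = inj₂ refl
    ... | 1F , refl rewrite S.b∉Y | T.b∉Y with () ← Yw
    ... | 3F , refl rewrite S.d∉Y | T.d∉Y with () ← Yw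

    S⇒Y : ∀ {v} → S.Y v ≡ true → Y v ≡ true
    S⇒Y Sv rewrite Sv = refl

    S-or-T : ∀ {v} → Y v ≡ true → S.Y v ≡ true ⊎ (S.Y v ≡ false × T.Y v ≡ true)
    S-or-T {v} Yv with S.Y v
    ... | true  = inj₁ refl
    ... | false = inj₂ (refl , Yv)

    s∉t : ∀ {x} → inM x ≡ false → member s x ≡ true → member t x ≡ false
    s∉t x∉M x∈s = trans (complementary x∉M) (cong not x∈s)

    ¬s⇒t : ∀ {x} → inM x ≡ false → member s x ≡ false → member t x ≡ true
    ¬s⇒t x∉M x∉s = trans (complementary x∉M) (cong not x∉s)

    t∉s : ∀ {x} → inM x ≡ false → member t x ≡ true → member s x ≡ false
    t∉s {x} x∉M x∈t with true-or-false (member s x)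
    ... | inj₂ x∉s = x∉s
    ... | inj₁ x∈s with () ← trans (sym x∈t) (s∉t x∉M x∈s)

    s∉T : ∀ {x} → inM x ≡ false → member s x ≡ true → T.Y x ≡ false
    s∉T {x} x∉M x∈s with true-or-false (T.Y x)
    ... | inj₂ x∉T = x∉T
    ... | inj₁ x∈T with () ← trans (sym (part⇒member t (T.Y⊆part x∈T) x∉M)) (s∉t x∉M x∈s)

    step-s : ∀ {x w} → member s x ≡ true → Y x ≡ false → Adj G x w →
             WalkOutside diagonal s S.Y w (f 3F) → WalkOutside diagonal s S.Y x (f 3F)
    step-s x∈s x∉Y xw = step (member⇒part s x∈s , ∨-conicalˡ _ _ x∉Y) (Adj-∪ᴱ⁺ G diagonal xw)

    step-t : ∀ {x w} → member t x ≡ true → Y x ≡ false → Adj G x w →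
             WalkOutside ∅ᴱ t T.Y w (f 3F) → WalkOutside ∅ᴱ t T.Y x (f 3F)
    step-t x∈t x∉Y xw = step (member⇒part t x∈t , ∨-conicalʳ _ _ x∉Y) (Adj-∪ᴱ⁺ G ∅ᴱ xw)

    -- The invariant along a walk to f3 in G − Y: it never visits f1, since the stretch after its last
    -- visit to f1 would stay inside one part and reach f3 avoiding that part's separator.
    record Escape (x : V) : Set where
      field
        ≢f1   : x ≢ f 1F
        via-s : inM x ≡ false → member s x ≡ true → WalkOutside diagonal s S.Y x (f 3F)
        via-t : inM x ≡ false → member t x ≡ true → WalkOutside ∅ᴱ t T.Y x (f 3F)

    escape-f3 : Escape (f 3F)
    escape-f3 = record
      { ≢f1   = 3≢1 ∘ f-injective
      ; via-s = λ f3∉M → ⊥-elim (true≢false (trans (sym (inM-f 3F)) f3∉M))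
      ; via-t = λ f3∉M → ⊥-elim (true≢false (trans (sym (inM-f 3F)) f3∉M))
      }
      where
      3≢1 : 3F ≢ 1F
      3≢1 ()

    escape-into-f3 : ∀ {x} → Y x ≡ false → Adj G x (f 3F) → Escape x
    escape-into-f3 x∉Y x~f3 = record
      { ≢f1   = λ { refl → true≢false (trans (sym x~f3) (f-adj 1F 3F)) }
      ; via-s = λ _ x∈s → step-s x∈s x∉Y x~f3 (here (part-f s 3F , S.d∉Y))
      ; via-t = λ _ x∈t → step-t x∈t x∉Y x~f3 (here (part-f t 3F , T.d∉Y))
      }

    escape-into-s : ∀ {x w} → Y x ≡ false → Adj G x w → inM w ≡ false → member s w ≡ true → Escape w → Escape x
    escape-into-s x∉Y xw w∉M w∈s E = record
      { ≢f1   = λ { refl → S.separates (step (part-f s 1F , S.b∉Y) (Adj-∪ᴱ⁺ G diagonal xw) (Escape.via-s E w∉M w∈s)) }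
      ; via-s = λ _ x∈s → step-s x∈s x∉Y xw (Escape.via-s E w∉M w∈s)
      ; via-t = λ x∉M x∈t → ⊥-elim (true≢false (trans (sym (closed t x∉M x∈t xw w∉M)) (s∉t w∉M w∈s)))
      }

    escape-into-t : ∀ {x w} → Y x ≡ false → Adj G x w → inM w ≡ false → member t w ≡ true → Escape w → Escape x
    escape-into-t x∉Y xw w∉M w∈t E = record
      { ≢f1   = λ { refl → T.separates (step (part-f t 1F , T.b∉Y) (Adj-∪ᴱ⁺ G ∅ᴱ xw) (Escape.via-t E w∉M w∈t)) }
      ; via-s = λ x∉M x∈s → ⊥-elim (true≢false (trans (sym (closed s x∉M x∈s xw w∉M)) (t∉s w∉M w∈t)))
      ; via-t = λ _ x∈t → step-t x∈t x∉Y xw (Escape.via-t E w∉M w∈t)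
      }

    escape : ∀ {x} → Walk (Adj G) (λ v → Y v ≡ false) x (f 3F) → Escape x
    escape (here _) = escape-f3
    escape (step {y = w} x∉Y xw c) with true-or-false (inM w)
    ... | inj₂ w∉M with true-or-false (member s w)
    ...   | inj₁ w∈s = escape-into-s x∉Y xw w∉M w∈s (escape c)
    ...   | inj₂ w∉s = escape-into-t x∉Y xw w∉M (¬s⇒t w∉M w∉s) (escape c)
    escape (step x∉Y xw c) | inj₁ w∈M with inM⇒f w∈M
    ... | 3F , refl = escape-into-f3 x∉Y xw
    ... | 1F , refl = ⊥-elim (Escape.≢f1 (escape c) refl)
    ... | 0F , refl with () ← trans (sym S.a∈Y) (∨-conicalˡ _ _ (source-ok c))
    ... | 2F , refl with () ← trans (sym S.c∈Y) (∨-conicalˡ _ _ (source-ok c))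

    module Reroute {x} (x∉M : inM x ≡ false) (x∈s : member s x ≡ true) where

      WalkY WalkS : V → V → Set
      WalkY = Walk (Adj G) (λ v → Y v ≡ true × v ≢ x)
      WalkS = Walk (Adj (G ∪ᴱ diagonal)) (λ v → S.Y v ≡ true × v ≢ x)

      f≢x : ∀ i → f i ≢ x
      f≢x i fi≡x with () ← trans (sym (inM-f i)) (subst (λ v → inM v ≡ false) (sym fi≡x) x∉M)

      enter-S : ∀ {a b} → inM a ≡ true → S.Y a ≡ true → WalkS (f 0F) b ⊎ WalkS (f 2F) b → WalkS a b
      enter-S a∈M Sa from-M with Y∩M a∈M (S⇒Y Sa)
      enter-S a∈M Sa (inj₁ w) | inj₁ refl = w
      enter-S a∈M Sa (inj₂ w) | inj₁ refl =
        step (S.a∈Y , f≢x 0F) (Adj-∪ᴱ⁺ʳ G diagonal (isPair-pq (f 0F) (f 2F))) w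
      enter-S a∈M Sa (inj₁ w) | inj₂ refl =
        step (S.c∈Y , f≢x 2F) (Adj-∪ᴱ⁺ʳ G diagonal (isPair-qp (f 0F) (f 2F))) w
      enter-S a∈M Sa (inj₂ w) | inj₂ refl = w

      -- The excursions of a walk into the t-side leave and re-enter M at f0 or f2; they are replaced by
      -- the diagonal.
      reroute : ∀ {a b} → WalkY a b → S.Y b ≡ true →
                (S.Y a ≡ true → WalkS a b) ×
                (inM a ≡ false → member t a ≡ true → WalkS (f 0F) b ⊎ WalkS (f 2F) b)
      reroute (here (_ , b≢x)) Sb =
          (λ Sa → here (Sa , b≢x))
        , (λ b∉M b∈t → ⊥-elim (true≢false (trans (sym (part⇒member s (S.Y⊆part Sb) b∉M)) (t∉s b∉M b∈t))))
      reroute {a} {b} (step {y = w} (_ , a≢x) aw c) Sb with reroute c Sb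
      ... | from-w , from-t-w = from-a , from-t-a
        where
        Yw : Y w ≡ true
        Yw = proj₁ (source-ok c)
        from-a : S.Y a ≡ true → WalkS a b
        from-a Sa with S-or-T Yw
        ... | inj₁ Sw = step (Sa , a≢x) (Adj-∪ᴱ⁺ G diagonal aw) (from-w Sw)
        ... | inj₂ (Sw , Tw) with true-or-false (inM w)
        ...   | inj₁ w∈M with Y∩M w∈M Yw
        ...     | inj₁ refl with () ← trans (sym S.a∈Y) Sw
        ...     | inj₂ refl with () ← trans (sym S.c∈Y) Sw
        from-a Sa | inj₂ (Sw , Tw) | inj₂ w∉M with true-or-false (inM a)
        ...     | inj₁ a∈M = enter-S a∈M Sa (from-t-w w∉M (part⇒member t (T.Y⊆part Tw) w∉M))
        ...     | inj₂ a∉M with () ← trans (sym (closed s a∉M (part⇒member s (S.Y⊆part Sa) a∉M) aw w∉M))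
                                          (t∉s w∉M (part⇒member t (T.Y⊆part Tw) w∉M))
        from-t-a : inM a ≡ false → member t a ≡ true → WalkS (f 0F) b ⊎ WalkS (f 2F) b
        from-t-a a∉M a∈t with true-or-false (inM w)
        ... | inj₂ w∉M = from-t-w w∉M (closed t a∉M a∈t aw w∉M)
        ... | inj₁ w∈M with Y∩M w∈M Yw
        ...   | inj₁ refl = inj₁ (from-w S.a∈Y)
        ...   | inj₂ refl = inj₂ (from-w S.c∈Y)

      neighbour∈S : ∀ {v} → Adj G x v → Y v ≡ true → S.Y v ≡ true
      neighbour∈S {v} xv Yv with true-or-false (inM v)
      ... | inj₁ v∈M with Y∩M v∈M Yv
      ...   | inj₁ refl = S.a∈Y
      ...   | inj₂ refl = S.c∈Y
      neighbour∈S {v} xv Yv | inj₂ v∉M = ∨-true-left Yv (s∉T v∉M (closed s x∉M x∈s xv v∉M))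

      reroute-detour : Detour G Y x → Detour (G ∪ᴱ diagonal) S.Y x
      reroute-detour d = record
        { walk     = proj₁ (reroute walk (neighbour∈S (Adj-sym G leave) (proj₁ (target-ok walk))))
                           (neighbour∈S enter (proj₁ (source-ok walk)))
        ; distinct = distinct
        ; enter    = Adj-∪ᴱ⁺ G diagonal enter
        ; leave    = Adj-∪ᴱ⁺ G diagonal leave
        }
        where open Detour d

    -- A cycle of G[Y] avoiding s \ M lies in T.Y; one through x ∈ s \ M reroutes to a cycle of S.Y.
    Y-forest : ¬ CycleIn G (tabulate Y)
    Y-forest c with any? (λ i → (inM (CycleIn.vs c i) ≟ᵇ false) ×-dec (member s (CycleIn.vs c i) ≟ᵇ true))
    ... | yes (i , x∉M , x∈s) =
      S.forest (detour⇒cycle (G ∪ᴱ diagonal) (reroute-detour pivot-detour) Sx)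
      where
      open CycleIn c
      open Reroute x∉M x∈s
      pivot-detour : Detour G Y (vs i)
      pivot-detour with c′ , c′₀≡vsᵢ ← rotate-to G c i = subst (Detour G Y) c′₀≡vsᵢ (cycle⇒detour G c′)
      Sx : S.Y (vs i) ≡ true
      Sx = ∨-true-left (∈-tabulate⁻ Y (inside i)) (s∉T x∉M x∈s)
    ... | no ∄pivot = T.forest (CycleIn-∪ᴱ G ∅ᴱ record
      { k = k ; vs = vs ; inj = inj ; inside = ∈-tabulate⁺ T.Y ∘ in-T ; edges = edges ; closing = closing })
      where
      open CycleIn c
      in-T : ∀ i → T.Y (vs i) ≡ true
      in-T i with true-or-false (inM (vs i)) | ∈-tabulate⁻ Y (inside i)
      ... | inj₁ v∈M | Yv with Y∩M v∈M Yv
      ...   | inj₁ eq = subst (λ v → T.Y v ≡ true) (sym eq) T.a∈Y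
      ...   | inj₂ eq = subst (λ v → T.Y v ≡ true) (sym eq) T.c∈Y
      in-T i | inj₂ v∉M | Yv with S-or-T Yv
      ...   | inj₂ (_ , Tv) = Tv
      ...   | inj₁ Sv = ⊥-elim (∄pivot (i , v∉M , part⇒member s (S.Y⊆part Sv) v∉M))

    contradiction : ⊥
    contradiction = noForestCut (tabulate Y)
      ((f 1F , f 3F , ∉-tabulate⁺ Y Y-f1 , ∉-tabulate⁺ Y Y-f3 , separated) , Y-forest)
      where
      Y-f1 : Y (f 1F) ≡ false
      Y-f1 rewrite S.b∉Y | T.b∉Y = refl
      Y-f3 : Y (f 3F) ≡ false
      Y-f3 rewrite S.d∉Y | T.d∉Y = refl
      separated : ¬ ConnAvoid G (tabulate Y) (f 1F) (f 3F)
      separated c = Escape.≢f1 (escape (ConnAvoid⇒Walk Y c)) refl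

  no-crossing-separators : ∀ s t → (∀ {x} → inM x ≡ false → member t x ≡ not (member s x)) →
                           ForestSeparator diagonal s (f 0F) (f 1F) (f 2F) (f 3F) →
                           ¬ ForestSeparator ∅ᴱ t (f 0F) (f 1F) (f 2F) (f 3F)
  no-crossing-separators s t complementary S T = Crossing.contradiction s t complementary S T

module QAdditivity where

  open import Data.Integer using (+_)
  import Data.Integer as ℤ
  import Data.Integer.Properties as ℤ
  open import Data.Nat using () renaming (_+_ to _+ℕ_)
  open import Data.Nat.Coprimality using (1-coprimeTo) renaming (sym to coprime-sym)
  open import Data.Rational using (mkℚ; _/_; _+_; _*_; _-_)
  open import Data.Rational.Properties using (normalize-coprime)
  open import Data.Rational.Solver using (module +-*-Solver)

  ℕ→ℚ≡mkℚ : ∀ k → ℕ→ℚ k ≡ mkℚ (+ k) 0 (coprime-sym (1-coprimeTo k))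
  ℕ→ℚ≡mkℚ k = normalize-coprime (coprime-sym (1-coprimeTo k))

  ℕ→ℚ-+ : ∀ a b → ℕ→ℚ (a +ℕ b) ≡ ℕ→ℚ a + ℕ→ℚ b
  ℕ→ℚ-+ a b rewrite ℕ→ℚ≡mkℚ a | ℕ→ℚ≡mkℚ b =
    cong (_/ 1) (sym (cong₂ Data.Integer._+_ (ℤ.*-identityʳ (+ a)) (ℤ.*-identityʳ (+ b))))

  q-additive : ∀ α β (H₁ H₂ G : Graph) → n H₁ +ℕ n H₂ ≡ n G +ℕ 4 →
           edgeCount H₁ +ℕ edgeCount H₂ ≡ edgeCount G +ℕ 6 → ℕ→ℚ 4 * α - β ≡ ℕ→ℚ 6 →
           q α β H₁ + q α β H₂ ≡ q α β G
  q-additive α β H₁ H₂ G vertices edges balance = begin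
    q α β H₁ + q α β H₂
      ≡⟨ solve 6 (λ α β N₁ N₂ e₁ e₂ → ((α :* N₁ :- e₁) :- β) :+ ((α :* N₂ :- e₂) :- β)
                                     := (α :* (N₁ :+ N₂) :- (e₁ :+ e₂)) :- (β :+ β))
               refl α β (ℕ→ℚ (n H₁)) (ℕ→ℚ (n H₂)) (ℕ→ℚ (edgeCount H₁)) (ℕ→ℚ (edgeCount H₂)) ⟩
    (α * (ℕ→ℚ (n H₁) + ℕ→ℚ (n H₂)) - (ℕ→ℚ (edgeCount H₁) + ℕ→ℚ (edgeCount H₂))) - (β + β)
      ≡⟨ cong₂ (λ N e → (α * N - e) - (β + β)) (ℕ→ℚ-sum (n H₁) (n H₂) (n G) 4 vertices)
                                                (ℕ→ℚ-sum (edgeCount H₁) (edgeCount H₂) (edgeCount G) 6 edges) ⟩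
    (α * (ℕ→ℚ (n G) + ℕ→ℚ 4) - (ℕ→ℚ (edgeCount G) + ℕ→ℚ 6)) - (β + β)
      ≡⟨ solve 6 (λ α β N e c₄ c₆ → (α :* (N :+ c₄) :- (e :+ c₆)) :- (β :+ β)
                                   := ((α :* N :- e) :- β) :+ ((c₄ :* α :- β) :- c₆))
               refl α β (ℕ→ℚ (n G)) (ℕ→ℚ (edgeCount G)) (ℕ→ℚ 4) (ℕ→ℚ 6) ⟩
    q α β G + ((ℕ→ℚ 4 * α - β) - ℕ→ℚ 6)
      ≡⟨ cong (λ z → q α β G + (z - ℕ→ℚ 6)) balance ⟩
    q α β G + (ℕ→ℚ 6 - ℕ→ℚ 6)
      ≡⟨ solve 2 (λ x c → x :+ (c :- c) := x) refl (q α β G) (ℕ→ℚ 6) ⟩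
    q α β G
      ∎
    where
    open ≡-Reasoning
    open +-*-Solver
    ℕ→ℚ-sum : ∀ a b c d → a +ℕ b ≡ c +ℕ d → ℕ→ℚ a + ℕ→ℚ b ≡ ℕ→ℚ c + ℕ→ℚ d
    ℕ→ℚ-sum a b c d eq = trans (sym (ℕ→ℚ-+ a b)) (trans (cong ℕ→ℚ eq) (ℕ→ℚ-+ c d))

module Contradiction (α β : ℚ) (balance : ℕ→ℚ 4 ℚ.* α ℚ.- β ≡ ℕ→ℚ 6)
                     (G : Graph) (G∈𝒢 : In𝒢 𝔉 α β G)
                     (M : Subset (n G)) (M-cut : IsVertexCut G M) (C : InducedC4 G M) where

  open import Data.Nat using (_+_; _≤_)
  open import Data.Nat.Properties using (<⇒≱)
  import Data.Rational.Properties as ℚₚ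
  open Counting
  open QAdditivity

  private
    V : Set
    V = Fin (n G)
    q>0 : 0ℚ ℚ.< q α β G
    q>0 = proj₁ (proj₂ (proj₁ G∈𝒢))
    G-noCut : HasNoΨCut 𝔉 G
    G-noCut = proj₂ (proj₂ (proj₁ G∈𝒢))
    minimal : ∀ H → Admissible 𝔉 α β H → n G ≤ n H
    minimal = proj₂ G∈𝒢

  open C4Cut G M C G-noCut
  module C′ = C4Cut G M (rotateC4 {G} {M} C) G-noCut

  u v : V
  u = proj₁ M-cut
  v = proj₁ (proj₂ M-cut)

  u∉M : inM u ≡ false
  u∉M = ∉⇒lookup (proj₁ (proj₂ (proj₂ M-cut)))

  v∉M : inM v ≡ false
  v∉M = ∉⇒lookup (proj₁ (proj₂ (proj₂ (proj₂ M-cut))))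

  u≁v : ¬ Walk (Adj G) (λ x → inM x ≡ false) u v
  u≁v = proj₂ (proj₂ (proj₂ (proj₂ M-cut))) ∘ Walk⇒ConnAvoid

  Reach : V → Set
  Reach = Walk (Adj G) (λ x → inM x ≡ false) u

  module _ (reach? : ∀ x → Dec (Reach x)) where

    A B : Side
    A = record { member = does ∘ reach? ; closed = closed-A }
      where
      closed-A : ∀ {x y} → inM x ≡ false → does (reach? x) ≡ true → Adj G x y → inM y ≡ false →
                 does (reach? y) ≡ true
      closed-A {x} {y} _ x∈A xy y∉M with reach? x | reach? y
      ... | yes u~x | yes _  = refl
      ... | yes u~x | no u≁y = ⊥-elim (u≁y (snocʷ u~x xy y∉M))
    B = complement A

    u∉B : part B u ≡ false
    u∉B rewrite u∉M with reach? u
    ... | yes _  = refl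
    ... | no u≁u = ⊥-elim (u≁u (here u∉M))

    v∉A : part A v ≡ false
    v∉A rewrite v∉M with reach? v
    ... | yes u~v = ⊥-elim (u≁v u~v)
    ... | no _    = refl

    q≤0 : ∀ s X x → part s x ≡ false → HasNoΨCut 𝔉 (partGraph s X) → q α β (partGraph s X) ℚ.≤ 0ℚ
    q≤0 s X x x∉part noCut = ℚₚ.≮⇒≥ λ q>0′ →
      <⇒≱ (count< (part s) x x∉part) (minimal (partGraph s X) (four≤ , q>0′ , noCut))
      where
      four≤ : 4 ≤ count (part s)
      four≤ = subst (_≤ count (part s)) count-M (count-mono {P = inM} (λ _ → inM⇒part s))

    no-cut-free-parts : ∀ X Y → SupportedOnM X → SupportedOnM Y → degreeOnM X + degreeOnM Y ≡ 20 →
           HasNoΨCut 𝔉 (partGraph A X) → HasNoΨCut 𝔉 (partGraph B Y) → ⊥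
    no-cut-free-parts X Y X⊆M Y⊆M degrees noCutA noCutB = ℚₚ.<-irrefl refl (ℚₚ.<-≤-trans q>0 (subst (ℚ._≤ 0ℚ) q-sum
      (ℚₚ.+-mono-≤ (q≤0 A X v v∉A noCutA) (q≤0 B Y u u∉B noCutB))))
      where
      q-sum : q α β (partGraph A X) ℚ.+ q α β (partGraph B Y) ≡ q α β G
      q-sum = q-additive α β (partGraph A X) (partGraph B Y) G (trans (count-parts A) (cong (n G +_) count-M))
                (edgeCount-parts A X Y X⊆M Y⊆M degrees) balance

    SA SB TA TB : Set
    SA = ForestSeparator diagonal A (f 0F) (f 1F) (f 2F) (f 3F)
    SB = ForestSeparator diagonal B (f 0F) (f 1F) (f 2F) (f 3F)
    TA = ForestSeparator antidiagonal A (f 1F) (f 2F) (f 3F) (f 0F)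
    TB = ForestSeparator antidiagonal B (f 1F) (f 2F) (f 3F) (f 0F)

    A→B : ∀ {x} → inM x ≡ false → member B x ≡ not (member A x)
    A→B _ = refl

    B→A : ∀ {x} → inM x ≡ false → member A x ≡ not (member B x)
    B→A {x} _ = sym (not-involutive (member A x))

    by-cases : Dec SA → Dec SB → Dec TA → Dec TB → ⊥
    by-cases (no ¬SA) (no ¬SB) _ _ =
      no-cut-free-parts diagonal diagonal diagonal-supported diagonal-supported
        (cong₂ _+_ degreeOnM-diagonal degreeOnM-diagonal)
        (noForestCut-diagonal A ¬SA) (noForestCut-diagonal B ¬SB)
    by-cases _ _ (no ¬TA) (no ¬TB) =
      no-cut-free-parts antidiagonal antidiagonal antidiagonal-supported antidiagonal-supported
        (cong₂ _+_ degreeOnM-antidiagonal degreeOnM-antidiagonal)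
        (C′.noForestCut-diagonal A ¬TA) (C′.noForestCut-diagonal B ¬TB)
    by-cases (yes SA) _ (yes TA) _ =
      no-cut-free-parts (diagonal ∪ˢ antidiagonal) ∅ᴱ both-supported (λ ()) (cong₂ _+_ degreeOnM-both degreeOnM-∅)
        (noForestCut-both A)
        (noForestCut-part B ∅ᴱ (no-crossing-separators A B A→B SA) (C′.no-crossing-separators A B A→B TA))
    by-cases _ (yes SB) _ (yes TB) =
      no-cut-free-parts ∅ᴱ (diagonal ∪ˢ antidiagonal) (λ ()) both-supported (cong₂ _+_ degreeOnM-∅ degreeOnM-both)
        (noForestCut-part A ∅ᴱ (no-crossing-separators B A B→A SB) (C′.no-crossing-separators B A B→A TB))
        (noForestCut-both B)
    by-cases (yes SA) _ _ (yes TB) =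
      no-cut-free-parts antidiagonal diagonal antidiagonal-supported diagonal-supported
        (cong₂ _+_ degreeOnM-antidiagonal degreeOnM-diagonal)
        (C′.noForestCut-diagonal A (C′.no-crossing-separators B A B→A TB ∘ weaken))
        (noForestCut-diagonal B (no-crossing-separators A B A→B SA ∘ weaken))
    by-cases _ (yes SB) (yes TA) _ =
      no-cut-free-parts diagonal antidiagonal diagonal-supported antidiagonal-supported
        (cong₂ _+_ degreeOnM-diagonal degreeOnM-antidiagonal)
        (noForestCut-diagonal A (no-crossing-separators B A B→A SB ∘ weaken))
        (C′.noForestCut-diagonal B (C′.no-crossing-separators A B A→B TA ∘ weaken))

  -- Reachability from u and the existence of the separators are only decided under double negation,
  -- which is enough since the goal is ⊥.
  contradiction : ⊥
  contradiction = ¬¬-decide Reach λ reach? →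
    ¬¬-excluded-middle λ SA? → ¬¬-excluded-middle λ SB? → ¬¬-excluded-middle λ TA? → ¬¬-excluded-middle λ TB? →
    by-cases reach? SA? SB? TA? TB?


open import Data.Rational using (_<_; _≤_; _-_; _*_)

lemma8 : (Ψ : GraphClass) (α β : ℚ) →
         ℕ→ℚ 2 < α → α ≤ ℕ→ℚ 3 → ℕ→ℚ 4 * α - β ≡ ℕ→ℚ 6 →
         (G : Graph) → In𝒢 Ψ α β G →
         ¬ (Σ (Subset (n G)) λ M → IsVertexCut G M × InducedC4 G M)
lemma8 𝔅 α β _ _ _       G ((_ , _ , noCut) , _) (M , M-cut , C) = noCut M (M-cut , InducedC4⇒InducedBipartite {G} C)
lemma8 𝔉 α β _ _ balance G G∈𝒢 (M , M-cut , C) = Contradiction.contradiction α β balance G G∈𝒢 M M-cut C
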